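{- Let $\mathfrak{d}^e_n$ and $\mathfrak{d}^o_n$ be the numbers of even and odd parity alternating derangements (PADs) of $[n]$, so that $\mathfrak{d}^e_0=1$, $\mathfrak{d}^o_0=0$ and $\mathfrak{d}^e_i=\mathfrak{d}^o_i=0$ for $i=1,2,3$. Then for every $n\ge 4$, with $s=\lfloor\frac{n-1}{2}\rfloor=\frac{2n-3-(-1)^n}{4}$, \[ \mathfrak{d}^e_n=s\Big(\mathfrak{d}^o_{n-1}+(n-2-s)\big(\mathfrak{d}^e_{n-3}+\mathfrak{d}^e_{n-4}\big)\Big),\qquad \mathfrak{d}^o_n=s\Big(\mathfrak{d}^e_{n-1}+(n-2-s)\big(\mathfrak{d}^o_{n-3}+\mathfrak{d}^o_{n-4}\big)\Big). \]
   Context: A permutation $\sigma$ of $[n]=\{1,\dots,n\}$, in one-line notation, is a PAP if $\sigma(i)\equiv i\pmod 2$ for all $i$ (entries alternate in parity, first entry odd); a PAD is a PAP that is a derangement ($\sigma(i)\ne i$ for all $i$). A permutation of $[n]$ is even or odd according to its sign $(-1)^{n-c}$, where $c$ is its number of cycles (fixed points included). The empty permutation is an even PAD. -}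

module Defs where

open import Data.Nat using (ℕ; zero; suc; _≤_; _∸_; _%_)
open import Data.Nat.Properties using (_≟_; _≤?_)
open import Data.Fin using (Fin; toℕ)
open import Data.Fin.Properties using (all?) renaming (_≟_ to _≟ᶠ_)
open import Data.Vec using (Vec; []; _∷_; lookup)
open import Data.List using (List; [_]; map; concatMap; filter; length; allFin)
open import Data.Product using (_×_)
open import Relation.Nullary using (¬_; Dec)
open import Relation.Nullary.Decidable using (_×-dec_; _→-dec_; ¬?)
open import Relation.Binary.PropositionalEquality using (_≡_)

-- [n] is modelled by Fin n (i ↦ i+1); a map [n] → [n] in one-line
-- notation is a vector of length n; a permutation is an injective one.

words : (n k : ℕ) → List (Vec (Fin n) k)
words n zero    = [ [] ]
words n (suc k) = concatMap (λ v → map (λ x → x ∷ v) (allFin n)) (words n k)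

IsPerm : ∀ {n} → Vec (Fin n) n → Set
IsPerm {n} v = ∀ (i j : Fin n) → lookup v i ≡ lookup v j → i ≡ j

isPerm? : ∀ {n} (v : Vec (Fin n) n) → Dec (IsPerm v)
isPerm? v = all? (λ i → all? (λ j → (lookup v i ≟ᶠ lookup v j) →-dec (i ≟ᶠ j)))

perms : (n : ℕ) → List (Vec (Fin n) n)
perms n = filter isPerm? (words n n)

-- PAP: σ(i) ≡ i (mod 2) for all i (0-based shift preserves this)
IsPAP : ∀ {n} → Vec (Fin n) n → Set
IsPAP {n} v = ∀ (i : Fin n) → toℕ (lookup v i) % 2 ≡ toℕ i % 2

IsDerangement : ∀ {n} → Vec (Fin n) n → Set
IsDerangement {n} v = ∀ (i : Fin n) → ¬ (lookup v i ≡ i)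

IsPAD : ∀ {n} → Vec (Fin n) n → Set
IsPAD v = IsPAP v × IsDerangement v

iter : ∀ {n} → Vec (Fin n) n → ℕ → Fin n → Fin n
iter v zero    i = i
iter v (suc k) i = lookup v (iter v k i)

-- i is the least element of its cycle: every σ^m(i), 1 ≤ m ≤ n, is ≥ i
IsCycleLeader : ∀ {n} → Vec (Fin n) n → Fin n → Set
IsCycleLeader {n} v i = ∀ (k : Fin n) → toℕ i ≤ toℕ (iter v (suc (toℕ k)) i)

isCycleLeader? : ∀ {n} (v : Vec (Fin n) n) (i : Fin n) → Dec (IsCycleLeader v i)
isCycleLeader? v i = all? (λ k → toℕ i ≤? toℕ (iter v (suc (toℕ k)) i))

-- number of cycles (fixed points included) = number of cycle leaders
cycles : ∀ {n} → Vec (Fin n) n → ℕ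
cycles {n} v = length (filter (isCycleLeader? v) (allFin n))

-- sign (-1)^(n - c): even iff n - c is even (c ≤ n always)
IsEvenPerm : ∀ {n} → Vec (Fin n) n → Set
IsEvenPerm {n} v = (n ∸ cycles v) % 2 ≡ 0

IsOddPerm : ∀ {n} → Vec (Fin n) n → Set
IsOddPerm {n} v = (n ∸ cycles v) % 2 ≡ 1

isPAD? : ∀ {n} (v : Vec (Fin n) n) → Dec (IsPAD v)
isPAD? v = all? (λ i → toℕ (lookup v i) % 2 ≟ toℕ i % 2)
           ×-dec all? (λ i → ¬? (lookup v i ≟ᶠ i))

isEvenPAD? : ∀ {n} (v : Vec (Fin n) n) → Dec (IsPAD v × IsEvenPerm v)
isEvenPAD? {n} v = isPAD? v ×-dec ((n ∸ cycles v) % 2 ≟ 0)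

isOddPAD? : ∀ {n} (v : Vec (Fin n) n) → Dec (IsPAD v × IsOddPerm v)
isOddPAD? {n} v = isPAD? v ×-dec ((n ∸ cycles v) % 2 ≟ 1)

dE : ℕ → ℕ
dE n = length (filter isEvenPAD? (perms n))

dO : ℕ → ℕ
dO n = length (filter isOddPAD? (perms n))

-- A PAP sends odd positions to odd ones and even positions to even ones, so a PAD of [n] is a pair of
-- derangements, of its ⌈n/2⌉ odd and of its ⌊n/2⌋ even positions, and its cycles are those of the pair.
-- With eₘ, oₘ the numbers of even and odd derangements of [m] this gives
--   𝔡ᵉₙ = e⌈n/2⌉ e⌊n/2⌋ + o⌈n/2⌉ o⌊n/2⌋   and   𝔡ᵒₙ = e⌈n/2⌉ o⌊n/2⌋ + o⌈n/2⌉ e⌊n/2⌋.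
-- Deleting the largest point from a derangement, together with its partner when the two form a
-- 2-cycle, reverses the sign and yields eₘ₊₂ = (m+1)(oₘ₊₁ + oₘ) and oₘ₊₂ = (m+1)(eₘ₊₁ + eₘ).
-- Substituting these into the product formulas gives the recurrence; it is a polynomial identity.
-- Cycles are counted by their least elements, which these deletions and the restriction to a parity
-- class preserve because they act monotonically on positions.
module Submission where

open import Defs
open import Data.Bool using (Bool; true; false; not)
open import Data.Empty using (⊥; ⊥-elim)
open import Level using (0ℓ)
open import Data.Fin as Fin using (Fin; zero; suc; toℕ; fromℕ; fromℕ<; punchIn; punchOut)
import Data.Fin.Properties as Finₚ
open import Data.List as List using (List; []; _∷_; length; filter; map; _++_; allFin; cartesianProduct; concatMap)
import Data.List.Properties as Listₚ
open import Data.List.Membership.Propositional using (_∈_; find)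
import Data.List.Membership.Propositional.Properties as ∈ₚ
open import Data.List.Relation.Unary.All as All using (All; []; _∷_)
open import Data.List.Relation.Unary.Any as Any using (here)
import Data.List.Relation.Unary.Any.Properties as Anyₚ
open import Data.List.Relation.Unary.AllPairs using ([]; _∷_)
open import Data.List.Relation.Unary.Unique.Propositional using (Unique)
import Data.List.Relation.Unary.Unique.Propositional.Properties as Uniqueₚ
open import Data.Nat using (ℕ; zero; suc; _+_; _*_; _∸_; _≤_; _<_; z≤n; s≤s; _%_; _/_; ⌊_/2⌋; ⌈_/2⌉)
open import Data.Nat.Properties
open import Data.Nat.DivMod using (+-distrib-/; m%n<n)
open import Data.Nat.Tactic.RingSolver using (solve-∀)
open import Algebra.Properties.CommutativeSemigroup +-commutativeSemigroup using (interchange)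
open import Algebra.Properties.CommutativeMonoid.Sum +-0-commutativeMonoid using (sum; sum-remove; sum-cong-≗)
open import Data.Product as Product using (∃-syntax; _×_; _,_; proj₁; proj₂)
open import Data.Sum as Sum using (_⊎_; inj₁; inj₂; [_,_])
import Data.Sum.Properties as Sumₚ
open import Data.Unit using (⊤; tt)
open import Data.Vec using (Vec; []; _∷_; lookup; tabulate)
import Data.Vec.Properties as Vecₚ
open import Function using (_∘_; id; _⇔_; mk⇔; Equivalence)
import Function.Properties.Equivalence as ⇔
open import Relation.Nullary using (Dec; yes; no; ¬_)
open import Relation.Nullary.Decidable using (_×-dec_; ¬?)
open import Relation.Unary using (Pred; Decidable)
open import Relation.Binary.PropositionalEquality using (_≡_; _≢_; refl; sym; trans; cong; cong₂; subst; subst₂; module ≡-Reasoning)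

indicator : {P : Set} → Dec P → ℕ
indicator (yes _) = 1
indicator (no _)  = 0

indicator-yes : {P : Set} (p : Dec P) → P → indicator p ≡ 1
indicator-yes (yes _) _  = refl
indicator-yes (no ¬p) p = ⊥-elim (¬p p)

indicator-no : {P : Set} (p : Dec P) → ¬ P → indicator p ≡ 0
indicator-no (yes p) ¬p = ⊥-elim (¬p p)
indicator-no (no _)  _  = refl

indicator-⇔ : {P Q : Set} (p : Dec P) (q : Dec Q) → P ⇔ Q → indicator p ≡ indicator q
indicator-⇔ (yes _) (yes _) _   = refl
indicator-⇔ (yes p) (no ¬q) P⇔Q = ⊥-elim (¬q (Equivalence.to P⇔Q p))
indicator-⇔ (no ¬p) (yes q) P⇔Q = ⊥-elim (¬p (Equivalence.from P⇔Q q))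
indicator-⇔ (no _)  (no _)  _   = refl

indicator-× : {P Q : Set} (p : Dec P) (q : Dec Q) → indicator (p ×-dec q) ≡ indicator p * indicator q
indicator-× (yes _) (yes _) = refl
indicator-× (yes _) (no _)  = refl
indicator-× (no _)  (yes _) = refl
indicator-× (no _)  (no _)  = refl

count : {A : Set} {P : Pred A 0ℓ} → Decidable P → List A → ℕ
count P? xs = length (filter P? xs)

count-∷ : {A : Set} {P : Pred A 0ℓ} (P? : Decidable P) → ∀ x xs → count P? (x ∷ xs) ≡ indicator (P? x) + count P? xs
count-∷ P? x xs with P? x
... | yes _ = refl
... | no _  = refl

module _ {A : Set} {P : Pred A 0ℓ} (P? : Decidable P) where

  count-++ : ∀ xs ys → count P? (xs ++ ys) ≡ count P? xs + count P? ys
  count-++ xs ys = trans (cong length (Listₚ.filter-++ P? xs ys)) (Listₚ.length-++ (filter P? xs))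

  count-map : ∀ {B : Set} (f : B → A) xs → count P? (map f xs) ≡ count (P? ∘ f) xs
  count-map f []       = refl
  count-map f (x ∷ xs) = begin
    count P? (map f (x ∷ xs))                    ≡⟨ count-∷ P? (f x) (map f xs) ⟩
    indicator (P? (f x)) + count P? (map f xs)   ≡⟨ cong (indicator (P? (f x)) +_) (count-map f xs) ⟩
    indicator (P? (f x)) + count (P? ∘ f) xs     ≡˘⟨ count-∷ (P? ∘ f) x xs ⟩
    count (P? ∘ f) (x ∷ xs)                      ∎
    where open ≡-Reasoning

  count-tabulate : ∀ {n} (g : Fin n → A) → count P? (List.tabulate g) ≡ sum (λ i → indicator (P? (g i)))
  count-tabulate {zero}  g = refl
  count-tabulate {suc n} g =
    trans (count-∷ P? (g zero) (List.tabulate (g ∘ suc))) (cong (indicator (P? (g zero)) +_) (count-tabulate (g ∘ suc)))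

count-universal : {A : Set} (xs : List A) → count (λ (_ : A) → yes tt) xs ≡ length xs
count-universal []       = refl
count-universal (x ∷ xs) = cong suc (count-universal xs)

infixr 5 _⊎ˡ_
_⊎ˡ_ : {A B : Set} → List A → List B → List (A ⊎ B)
xs ⊎ˡ ys = map inj₁ xs ++ map inj₂ ys

module _ {A B : Set} {xs : List A} {ys : List B} where

  inj₁∈⁺ : ∀ {x} → x ∈ xs → inj₁ x ∈ xs ⊎ˡ ys
  inj₁∈⁺ x∈ = ∈ₚ.∈-++⁺ˡ (∈ₚ.∈-map⁺ inj₁ x∈)

  inj₂∈⁺ : ∀ {y} → y ∈ ys → inj₂ y ∈ xs ⊎ˡ ys
  inj₂∈⁺ y∈ = ∈ₚ.∈-++⁺ʳ (map inj₁ xs) (∈ₚ.∈-map⁺ inj₂ y∈)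

  inj₁∈⁻ : ∀ {x} → inj₁ x ∈ xs ⊎ˡ ys → x ∈ xs
  inj₁∈⁻ x∈ with ∈ₚ.∈-++⁻ (map inj₁ xs) x∈
  ... | inj₁ x∈₁ with ∈ₚ.∈-map⁻ inj₁ x∈₁
  ...   | _ , x∈xs , refl = x∈xs
  inj₁∈⁻ x∈ | inj₂ x∈₂ with ∈ₚ.∈-map⁻ inj₂ x∈₂
  ...   | _ , _ , ()

  inj₂∈⁻ : ∀ {y} → inj₂ y ∈ xs ⊎ˡ ys → y ∈ ys
  inj₂∈⁻ y∈ with ∈ₚ.∈-++⁻ (map inj₁ xs) y∈
  ... | inj₁ y∈₁ with ∈ₚ.∈-map⁻ inj₁ y∈₁
  ...   | _ , _ , ()
  inj₂∈⁻ y∈ | inj₂ y∈₂ with ∈ₚ.∈-map⁻ inj₂ y∈₂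
  ...   | _ , y∈ys , refl = y∈ys

  ⊎ˡ-unique : Unique xs → Unique ys → Unique (xs ⊎ˡ ys)
  ⊎ˡ-unique unique-xs unique-ys =
    Uniqueₚ.++⁺ (Uniqueₚ.map⁺ Sumₚ.inj₁-injective unique-xs) (Uniqueₚ.map⁺ Sumₚ.inj₂-injective unique-ys)
      λ (z∈₁ , z∈₂) → inj₁≢inj₂ (∈ₚ.∈-map⁻ inj₁ z∈₁) (∈ₚ.∈-map⁻ inj₂ z∈₂)
    where
    inj₁≢inj₂ : ∀ {z} → ∃[ x ] (x ∈ xs × z ≡ inj₁ x) → ∃[ y ] (y ∈ ys × z ≡ inj₂ y) → ⊥
    inj₁≢inj₂ (_ , _ , refl) (_ , _ , ())

module _ {A B : Set} {P : Pred A 0ℓ} {Q : Pred B 0ℓ} (P? : Decidable P) (Q? : Decidable Q) where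

  _×?_ : Decidable (λ (p : A × B) → P (proj₁ p) × Q (proj₂ p))
  _×?_ (a , b) = P? a ×-dec Q? b

  _⊎?_ : Decidable [ P , Q ]
  _⊎?_ (inj₁ a) = P? a
  _⊎?_ (inj₂ b) = Q? b

  count-cartesianProduct : ∀ xs ys → count _×?_ (cartesianProduct xs ys) ≡ count P? xs * count Q? ys
  count-cartesianProduct []       ys = refl
  count-cartesianProduct (x ∷ xs) ys = begin
    count _×?_ (map (x ,_) ys ++ cartesianProduct xs ys)
      ≡⟨ count-++ _×?_ (map (x ,_) ys) (cartesianProduct xs ys) ⟩
    count _×?_ (map (x ,_) ys) + count _×?_ (cartesianProduct xs ys)
      ≡⟨ cong₂ _+_ (count-row ys) (count-cartesianProduct xs ys) ⟩
    indicator (P? x) * count Q? ys + count P? xs * count Q? ys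
      ≡˘⟨ *-distribʳ-+ (count Q? ys) (indicator (P? x)) (count P? xs) ⟩
    (indicator (P? x) + count P? xs) * count Q? ys
      ≡˘⟨ cong (_* count Q? ys) (count-∷ P? x xs) ⟩
    count P? (x ∷ xs) * count Q? ys ∎
    where
    open ≡-Reasoning
    count-row : ∀ ys → count _×?_ (map (x ,_) ys) ≡ indicator (P? x) * count Q? ys
    count-row []       = sym (*-zeroʳ (indicator (P? x)))
    count-row (y ∷ ys) = begin
      count _×?_ ((x , y) ∷ map (x ,_) ys)
        ≡⟨ count-∷ _×?_ (x , y) (map (x ,_) ys) ⟩
      indicator (P? x ×-dec Q? y) + count _×?_ (map (x ,_) ys)
        ≡⟨ cong₂ _+_ (indicator-× (P? x) (Q? y)) (count-row ys) ⟩
      indicator (P? x) * indicator (Q? y) + indicator (P? x) * count Q? ys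
        ≡˘⟨ *-distribˡ-+ (indicator (P? x)) (indicator (Q? y)) (count Q? ys) ⟩
      indicator (P? x) * (indicator (Q? y) + count Q? ys)
        ≡˘⟨ cong (indicator (P? x) *_) (count-∷ Q? y ys) ⟩
      indicator (P? x) * count Q? (y ∷ ys) ∎

  count-⊎ : ∀ xs ys → count _⊎?_ (xs ⊎ˡ ys) ≡ count P? xs + count Q? ys
  count-⊎ xs ys = trans (count-++ _⊎?_ (map inj₁ xs) (map inj₂ ys))
    (cong₂ _+_ (count-map _⊎?_ inj₁ xs) (count-map _⊎?_ inj₂ ys))

lookup-injective : ∀ {A : Set} {xs : List A} → Unique xs → ∀ i j → List.lookup xs i ≡ List.lookup xs j → i ≡ j
lookup-injective (_ ∷ _)       zero    zero    _  = refl
lookup-injective (x∉xs ∷ _)    zero    (suc j) eq = ⊥-elim (All.lookup x∉xs (∈ₚ.∈-lookup j) eq)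
lookup-injective (x∉xs ∷ _)    (suc i) zero    eq = ⊥-elim (All.lookup x∉xs (∈ₚ.∈-lookup i) (sym eq))
lookup-injective (_ ∷ unique) (suc i) (suc j) eq = cong suc (lookup-injective unique i j eq)

length-≤-injection : ∀ {A B : Set} {xs : List A} {ys : List B} → Unique xs → (f : A → B) →
  (∀ {x} → x ∈ xs → f x ∈ ys) → (∀ {x y} → x ∈ xs → y ∈ xs → f x ≡ f y → x ≡ y) →
  length xs ≤ length ys
length-≤-injection {xs = xs} {ys} unique f f∈ f-inj = Finₚ.injective⇒≤ g-injective
  where
  g : Fin (length xs) → Fin (length ys)
  g i = Any.index (f∈ (∈ₚ.∈-lookup i))
  lookup-g : ∀ i → List.lookup ys (g i) ≡ f (List.lookup xs i)
  lookup-g i = sym (Anyₚ.lookup-index (f∈ (∈ₚ.∈-lookup i)))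
  g-injective : ∀ {i j} → g i ≡ g j → i ≡ j
  g-injective {i} {j} eq = lookup-injective unique i j (f-inj (∈ₚ.∈-lookup i) (∈ₚ.∈-lookup j)
    (trans (sym (lookup-g i)) (trans (cong (List.lookup ys) eq) (lookup-g j))))

count-≤-injection : ∀ {A B : Set} {P : Pred A 0ℓ} {Q : Pred B 0ℓ} (P? : Decidable P) (Q? : Decidable Q)
  {xs : List A} {ys : List B} → Unique xs → (f : A → B) →
  (∀ {x} → x ∈ xs → P x → f x ∈ ys × Q (f x)) →
  (∀ {x y} → x ∈ xs → y ∈ xs → P x → P y → f x ≡ f y → x ≡ y) →
  count P? xs ≤ count Q? ys
count-≤-injection P? Q? unique f f∈ f-inj = length-≤-injection (Uniqueₚ.filter⁺ P? unique) f
  (λ x∈ → let x∈xs , Px = ∈ₚ.∈-filter⁻ P? x∈ ; fx∈ys , Qfx = f∈ x∈xs Px in ∈ₚ.∈-filter⁺ Q? fx∈ys Qfx)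
  (λ x∈ y∈ → let x∈xs , Px = ∈ₚ.∈-filter⁻ P? x∈ ; y∈xs , Py = ∈ₚ.∈-filter⁻ P? y∈ in f-inj x∈xs y∈xs Px Py)

count-bijection : ∀ {A B : Set} {P : Pred A 0ℓ} {Q : Pred B 0ℓ} (P? : Decidable P) (Q? : Decidable Q)
  {xs : List A} {ys : List B} → Unique xs → Unique ys → (f : A → B) (g : B → A) →
  (∀ {x} → x ∈ xs → P x → f x ∈ ys × Q (f x)) →
  (∀ {y} → y ∈ ys → Q y → g y ∈ xs × P (g y)) →
  (∀ {x} → x ∈ xs → P x → g (f x) ≡ x) →
  (∀ {y} → y ∈ ys → Q y → f (g y) ≡ y) →
  count P? xs ≡ count Q? ys
count-bijection P? Q? unique-xs unique-ys f g f∈ g∈ gf fg = ≤-antisym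
  (count-≤-injection P? Q? unique-xs f f∈ (injective f g gf))
  (count-≤-injection Q? P? unique-ys g g∈ (injective g f fg))
  where
  injective : ∀ {C D : Set} {R : Pred C 0ℓ} {zs} (h : C → D) (h⁻¹ : D → C) → (∀ {z} → z ∈ zs → R z → h⁻¹ (h z) ≡ z) →
    ∀ {z z′} → z ∈ zs → z′ ∈ zs → R z → R z′ → h z ≡ h z′ → z ≡ z′
  injective h h⁻¹ inverse z∈ z′∈ Rz Rz′ eq = trans (sym (inverse z∈ Rz)) (trans (cong h⁻¹ eq) (inverse z′∈ Rz′))

count-disjoint-∪ : ∀ {A : Set} {P Q R : Pred A 0ℓ} (P? : Decidable P) (Q? : Decidable Q) (R? : Decidable R) →
  (∀ x → P x ⇔ (Q x ⊎ R x)) → (∀ x → Q x → R x → ⊥) → ∀ xs → count P? xs ≡ count Q? xs + count R? xs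
count-disjoint-∪ P? Q? R? P⇔Q∪R disjoint []       = refl
count-disjoint-∪ P? Q? R? P⇔Q∪R disjoint (x ∷ xs) = begin
  count P? (x ∷ xs)
    ≡⟨ count-∷ P? x xs ⟩
  indicator (P? x) + count P? xs
    ≡⟨ cong₂ _+_ (indicator-∪ (P? x) (Q? x) (R? x) (P⇔Q∪R x) (disjoint x)) (count-disjoint-∪ P? Q? R? P⇔Q∪R disjoint xs) ⟩
  (indicator (Q? x) + indicator (R? x)) + (count Q? xs + count R? xs)
    ≡⟨ interchange (indicator (Q? x)) _ _ _ ⟩
  (indicator (Q? x) + count Q? xs) + (indicator (R? x) + count R? xs)
    ≡˘⟨ cong₂ _+_ (count-∷ Q? x xs) (count-∷ R? x xs) ⟩
  count Q? (x ∷ xs) + count R? (x ∷ xs) ∎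
  where
  open ≡-Reasoning
  indicator-∪ : {P Q R : Set} (p : Dec P) (q : Dec Q) (r : Dec R) → P ⇔ (Q ⊎ R) → (Q → R → ⊥) →
    indicator p ≡ indicator q + indicator r
  indicator-∪ p (yes q) (yes r) _ disj = ⊥-elim (disj q r)
  indicator-∪ p (yes q) (no _)  P⇔ _    = indicator-yes p (Equivalence.from P⇔ (inj₁ q))
  indicator-∪ p (no _)  (yes r) P⇔ _    = indicator-yes p (Equivalence.from P⇔ (inj₂ r))
  indicator-∪ p (no ¬q) (no ¬r) P⇔ _    = indicator-no p λ x → [ ¬q , ¬r ] (Equivalence.to P⇔ x)

concatMap-unique : ∀ {A B : Set} (f : A → List B) {xs : List A} → Unique xs → (∀ x → Unique (f x)) →
  (∀ {x y z} → z ∈ f x → z ∈ f y → x ≡ y) → Unique (concatMap f xs)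
concatMap-unique f []                     _        _        = []
concatMap-unique f {x ∷ xs} (x∉xs ∷ uniq) f-unique disjoint =
  Uniqueₚ.++⁺ (f-unique x) (concatMap-unique f uniq f-unique disjoint) λ (z∈fx , z∈rest) →
    let y , y∈xs , z∈fy = find (∈ₚ.∈-concatMap⁻ f {xs = xs} z∈rest) in All.lookup x∉xs y∈xs (disjoint z∈fx z∈fy)

words-unique : ∀ n k → Unique (words n k)
words-unique n zero    = [] ∷ []
words-unique n (suc k) = concatMap-unique _ (words-unique n k)
  (λ _ → Uniqueₚ.map⁺ Vecₚ.∷-injectiveˡ (Uniqueₚ.allFin⁺ n))
  (λ z∈ z∈′ → let _ , _ , z≡ = ∈ₚ.∈-map⁻ _ z∈ ; _ , _ , z≡′ = ∈ₚ.∈-map⁻ _ z∈′ in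
    Vecₚ.∷-injectiveʳ (trans (sym z≡) z≡′))

∈-words : ∀ n k (v : Vec (Fin n) k) → v ∈ words n k
∈-words n zero    []      = here refl
∈-words n (suc k) (x ∷ v) = ∈ₚ.∈-concatMap⁺ _ {xs = words n k}
  (Any.map (λ { refl → ∈ₚ.∈-map⁺ (_∷ v) (∈ₚ.∈-allFin x) }) (∈-words n k v))

perms-unique : ∀ n → Unique (perms n)
perms-unique n = Uniqueₚ.filter⁺ isPerm? (words-unique n n)

∈-perms⁺ : ∀ {n} {v : Vec (Fin n) n} → IsPerm v → v ∈ perms n
∈-perms⁺ {n} {v} = ∈ₚ.∈-filter⁺ isPerm? (∈-words n n v)

∈-perms⁻ : ∀ {n} {v : Vec (Fin n) n} → v ∈ perms n → IsPerm v
∈-perms⁻ {n} v∈ = proj₂ (∈ₚ.∈-filter⁻ isPerm? {xs = words n n} v∈)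

-- Cycles as orbit minima

iter-+ : ∀ {n} (v : Vec (Fin n) n) a d i → iter v (a + d) i ≡ iter v a (iter v d i)
iter-+ v zero    d i = refl
iter-+ v (suc a) d i = cong (lookup v) (iter-+ v a d i)

iter-injective : ∀ {n} {v : Vec (Fin n) n} → IsPerm v → ∀ t {i j} → iter v t i ≡ iter v t j → i ≡ j
iter-injective perm zero    eq = eq
iter-injective perm (suc t) eq = iter-injective perm t (perm _ _ eq)

-- Pigeonhole on i, σ i, …, σⁿ⁺¹ i.
iter-period : ∀ {n} {v : Vec (Fin n) n} → IsPerm v → ∀ i → ∃[ p ] 0 < p × p ≤ n × iter v p i ≡ i
iter-period {suc n} {v} perm i with Finₚ.pigeonhole (n<1+n (suc n)) (λ (t : Fin (suc (suc n))) → iter v (toℕ t) i)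
... | a , b , a<b , eq = p , m<n⇒0<n∸m a<b , p≤ , sym (iter-injective perm (toℕ a) iterₐ≡iterₐ₊ₚ)
  where
  p = toℕ b ∸ toℕ a
  p≤ : p ≤ suc n
  p≤ = ≤-trans (m∸n≤m (toℕ b) (toℕ a)) (≤-pred (Finₚ.toℕ<n b))
  iterₐ≡iterₐ₊ₚ : iter v (toℕ a) i ≡ iter v (toℕ a) (iter v p i)
  iterₐ≡iterₐ₊ₚ = trans eq (trans (cong (λ t → iter v t i) (sym (m+[n∸m]≡n (<⇒≤ a<b)))) (iter-+ v (toℕ a) p i))

iter-below-period : ∀ {n} (v : Vec (Fin n) n) i p → 0 < p → iter v p i ≡ i →
  ∀ t → ∃[ u ] u < p × iter v t i ≡ iter v u i
iter-below-period v i p 0<p periodic zero    = 0 , 0<p , refl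
iter-below-period v i p 0<p periodic (suc t) with iter-below-period v i p 0<p periodic t
... | u , u<p , eq with m≤n⇒m<n∨m≡n u<p
...   | inj₁ 1+u<p = suc u , 1+u<p , cong (lookup v) eq
...   | inj₂ 1+u≡p = 0 , 0<p , trans (cong (lookup v) eq) (trans (cong (λ t → iter v t i) 1+u≡p) periodic)

IsOrbitMinimum : ∀ {n} → Vec (Fin n) n → Fin n → Set
IsOrbitMinimum v i = ∀ t → toℕ i ≤ toℕ (iter v t i)

-- IsCycleLeader inspects only σ¹ i, …, σⁿ i; they exhaust the orbit since σᵖ i = i for some 0 < p ≤ n.
orbitMinimum⇔cycleLeader : ∀ {n} {v : Vec (Fin n) n} {i} → IsPerm v → IsOrbitMinimum v i ⇔ IsCycleLeader v i
orbitMinimum⇔cycleLeader {n} {v} {i} perm = mk⇔ (λ min k → min (suc (toℕ k))) leader⇒min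
  where
  leader⇒min : IsCycleLeader v i → IsOrbitMinimum v i
  leader⇒min leader t with iter-period perm i
  ... | p , 0<p , p≤n , periodic with iter-below-period v i p 0<p periodic t
  ...   | zero  , _     , eq = subst (λ j → toℕ i ≤ toℕ j) (sym eq) ≤-refl
  ...   | suc u , 1+u<p , eq = subst (λ j → toℕ i ≤ toℕ j) (sym eq)
          (subst (λ s → toℕ i ≤ toℕ (iter v (suc s) i)) (Finₚ.toℕ-fromℕ< u<n) (leader (fromℕ< u<n)))
    where
    u<n : u < n
    u<n = ≤-trans (<⇒≤ 1+u<p) p≤n

cycles≡sum : ∀ {n} (v : Vec (Fin n) n) → cycles v ≡ sum (λ i → indicator (isCycleLeader? v i))
cycles≡sum {n} v = count-tabulate (isCycleLeader? v) id

cycles≤ : ∀ {n} (v : Vec (Fin n) n) → cycles v ≤ n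
cycles≤ {n} v = ≤-trans (Listₚ.length-filter (isCycleLeader? v) (allFin n)) (≤-reflexive (Listₚ.length-tabulate id))

-- n ∸ cycles σ is the least number of transpositions with product σ; its parity is the sign of σ.
reflectionLength : ∀ {n} → Vec (Fin n) n → ℕ
reflectionLength {n} v = n ∸ cycles v

cycles-transfer : ∀ {n m} {σ : Vec (Fin n) n} {τ : Vec (Fin m) m} (h : Fin m → Fin n) → IsPerm σ → IsPerm τ →
  (∀ x → IsOrbitMinimum σ (h x) ⇔ IsOrbitMinimum τ x) →
  sum (λ x → indicator (isCycleLeader? σ (h x))) ≡ cycles τ
cycles-transfer {σ = σ} {τ} h perm-σ perm-τ min⇔min = trans
  (sum-cong-≗ λ x → indicator-⇔ (isCycleLeader? σ (h x)) (isCycleLeader? τ x) (leader⇔leader x))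
  (sym (cycles≡sum τ))
  where
  leader⇔leader : ∀ x → IsCycleLeader σ (h x) ⇔ IsCycleLeader τ x
  leader⇔leader x = ⇔.trans (⇔.sym (orbitMinimum⇔cycleLeader perm-σ))
    (⇔.trans (min⇔min x) (orbitMinimum⇔cycleLeader perm-τ))

module OrderEmbedding {n m} (σ : Vec (Fin n) n) (τ : Vec (Fin m) m) (e : Fin m → Fin n)
  (e-mono : ∀ x y → toℕ x ≤ toℕ y → toℕ (e x) ≤ toℕ (e y))
  (e-cancel : ∀ x y → toℕ (e x) ≤ toℕ (e y) → toℕ x ≤ toℕ y)
  (σ∘e≡e∘τ : ∀ x → lookup σ (e x) ≡ e (lookup τ x)) where

  iter-e : ∀ t x → iter σ t (e x) ≡ e (iter τ t x)
  iter-e zero    x = refl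
  iter-e (suc t) x = trans (cong (lookup σ) (iter-e t x)) (σ∘e≡e∘τ _)

  orbitMinimum-e : ∀ x → IsOrbitMinimum σ (e x) ⇔ IsOrbitMinimum τ x
  orbitMinimum-e x = mk⇔
    (λ min t → e-cancel x _ (subst (λ j → toℕ (e x) ≤ toℕ j) (iter-e t x) (min t)))
    (λ min t → subst (λ j → toℕ (e x) ≤ toℕ j) (sym (iter-e t x)) (e-mono x _ (min t)))

  cycles-embedded : IsPerm σ → IsPerm τ → sum (λ x → indicator (isCycleLeader? σ (e x))) ≡ cycles τ
  cycles-embedded perm-σ perm-τ = cycles-transfer e perm-σ perm-τ orbitMinimum-e

-- Deleting a fixed point

vec-ext : ∀ {A : Set} {n} {u w : Vec A n} → (∀ x → lookup u x ≡ lookup w x) → u ≡ w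
vec-ext {u = u} {w} eq = trans (sym (Vecₚ.tabulate∘lookup u)) (trans (Vecₚ.tabulate-cong eq) (Vecₚ.tabulate∘lookup w))

punchIn-view : ∀ {n} (a y : Fin (suc n)) → y ≡ a ⊎ ∃[ x ] y ≡ punchIn a x
punchIn-view a y with a Fin.≟ y
... | yes a≡y = inj₁ (sym a≡y)
... | no a≢y  = inj₂ (punchOut a≢y , sym (Finₚ.punchIn-punchOut a≢y))

-- punchOut, with a junk value d for the one point a that has no image.
punchOutOr : ∀ {n} (a y : Fin (suc n)) → Fin n → Fin n
punchOutOr a y d with a Fin.≟ y
... | yes _   = d
... | no a≢y  = punchOut a≢y

punchIn-punchOutOr : ∀ {n} {a y : Fin (suc n)} d → a ≢ y → punchIn a (punchOutOr a y d) ≡ y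
punchIn-punchOutOr {a = a} {y} d a≢y with a Fin.≟ y
... | yes a≡y = ⊥-elim (a≢y a≡y)
... | no a≢y′ = Finₚ.punchIn-punchOut a≢y′

punchOutOr-punchIn : ∀ {n} (a : Fin (suc n)) x d → punchOutOr a (punchIn a x) d ≡ x
punchOutOr-punchIn a x d =
  Finₚ.punchIn-injective a _ _ (punchIn-punchOutOr d (λ eq → Finₚ.punchInᵢ≢i a x (sym eq)))

module FixedPoint {r : ℕ} (a : Fin (suc r)) where

  fixing : Vec (Fin r) r → Fin (suc r) → Fin (suc r)
  fixing τ y with a Fin.≟ y
  ... | yes _   = a
  ... | no a≢y  = punchIn a (lookup τ (punchOut a≢y))

  insertFixed : Vec (Fin r) r → Vec (Fin (suc r)) (suc r)
  insertFixed τ = tabulate (fixing τ)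

  deleteFixed : Vec (Fin (suc r)) (suc r) → Vec (Fin r) r
  deleteFixed σ = tabulate λ x → punchOutOr a (lookup σ (punchIn a x)) x

  insertFixed-a : ∀ τ → lookup (insertFixed τ) a ≡ a
  insertFixed-a τ = trans (Vecₚ.lookup∘tabulate (fixing τ) a) fixing-a
    where
    fixing-a : fixing τ a ≡ a
    fixing-a with a Fin.≟ a
    ... | yes _  = refl
    ... | no a≢a = ⊥-elim (a≢a refl)

  insertFixed-punchIn : ∀ τ x → lookup (insertFixed τ) (punchIn a x) ≡ punchIn a (lookup τ x)
  insertFixed-punchIn τ x = trans (Vecₚ.lookup∘tabulate (fixing τ) (punchIn a x)) fixing-punchIn
    where
    fixing-punchIn : fixing τ (punchIn a x) ≡ punchIn a (lookup τ x)
    fixing-punchIn with a Fin.≟ punchIn a x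
    ... | yes a≡ = ⊥-elim (Finₚ.punchInᵢ≢i a x (sym a≡))
    ... | no a≢  = cong (punchIn a ∘ lookup τ) (Finₚ.punchIn-injective a _ _ (Finₚ.punchIn-punchOut a≢))

  punchIn-deleteFixed : ∀ σ → IsPerm σ → lookup σ a ≡ a →
    ∀ x → punchIn a (lookup (deleteFixed σ) x) ≡ lookup σ (punchIn a x)
  punchIn-deleteFixed σ perm fixed x = trans (cong (punchIn a) (Vecₚ.lookup∘tabulate _ x))
    (punchIn-punchOutOr x (λ a≡ → Finₚ.punchInᵢ≢i a x (sym (perm _ _ (trans fixed a≡)))))

  deleteFixed-insertFixed : ∀ τ → deleteFixed (insertFixed τ) ≡ τ
  deleteFixed-insertFixed τ = vec-ext λ x → trans (Vecₚ.lookup∘tabulate _ x)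
    (trans (cong (λ y → punchOutOr a y x) (insertFixed-punchIn τ x)) (punchOutOr-punchIn a (lookup τ x) x))

  insertFixed-deleteFixed : ∀ σ → IsPerm σ → lookup σ a ≡ a → insertFixed (deleteFixed σ) ≡ σ
  insertFixed-deleteFixed σ perm fixed = vec-ext pointwise
    where
    pointwise : ∀ y → lookup (insertFixed (deleteFixed σ)) y ≡ lookup σ y
    pointwise y with punchIn-view a y
    ... | inj₁ refl       = trans (insertFixed-a _) (sym fixed)
    ... | inj₂ (x , refl) = trans (insertFixed-punchIn _ x) (punchIn-deleteFixed σ perm fixed x)

  deleteFixed-perm : ∀ σ → IsPerm σ → lookup σ a ≡ a → IsPerm (deleteFixed σ)
  deleteFixed-perm σ perm fixed x y eq = Finₚ.punchIn-injective a _ _ (perm _ _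
    (trans (sym (punchIn-deleteFixed σ perm fixed x)) (trans (cong (punchIn a) eq) (punchIn-deleteFixed σ perm fixed y))))

  insertFixed-perm : ∀ τ → IsPerm τ → IsPerm (insertFixed τ)
  insertFixed-perm τ perm y₁ y₂ eq with punchIn-view a y₁ | punchIn-view a y₂
  ... | inj₁ refl        | inj₁ refl         = refl
  ... | inj₁ refl        | inj₂ (x , refl)   =
    ⊥-elim (Finₚ.punchInᵢ≢i a _ (trans (sym (insertFixed-punchIn τ x)) (trans (sym eq) (insertFixed-a τ))))
  ... | inj₂ (x , refl)  | inj₁ refl         =
    ⊥-elim (Finₚ.punchInᵢ≢i a _ (trans (sym (insertFixed-punchIn τ x)) (trans eq (insertFixed-a τ))))
  ... | inj₂ (x , refl)  | inj₂ (x′ , refl)  = cong (punchIn a) (perm _ _ (Finₚ.punchIn-injective a _ _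
    (trans (sym (insertFixed-punchIn τ x)) (trans eq (insertFixed-punchIn τ x′)))))

  insertFixed-onlyFixed : ∀ τ → IsDerangement τ → ∀ y → lookup (insertFixed τ) y ≡ y → y ≡ a
  insertFixed-onlyFixed τ der y fixed with punchIn-view a y
  ... | inj₁ y≡a        = y≡a
  ... | inj₂ (x , refl) = ⊥-elim (der x (Finₚ.punchIn-injective a _ _ (trans (sym (insertFixed-punchIn τ x)) fixed)))

  deleteFixed-derangement : ∀ σ → IsPerm σ → lookup σ a ≡ a → (∀ y → lookup σ y ≡ y → y ≡ a) →
    IsDerangement (deleteFixed σ)
  deleteFixed-derangement σ perm fixed onlyFixed x eq = Finₚ.punchInᵢ≢i a x
    (onlyFixed _ (trans (sym (punchIn-deleteFixed σ perm fixed x)) (cong (punchIn a) eq)))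

  cycles-deleteFixed : ∀ σ → IsPerm σ → lookup σ a ≡ a → cycles σ ≡ suc (cycles (deleteFixed σ))
  cycles-deleteFixed σ perm fixed = begin
    cycles σ                           ≡⟨ cycles≡sum σ ⟩
    sum leads                          ≡⟨ sum-remove {i = a} leads ⟩
    leads a + sum (leads ∘ punchIn a)  ≡⟨ cong₂ _+_ a-leads (E.cycles-embedded perm (deleteFixed-perm σ perm fixed)) ⟩
    suc (cycles (deleteFixed σ))       ∎
    where
    open ≡-Reasoning
    leads : Fin (suc r) → ℕ
    leads i = indicator (isCycleLeader? σ i)
    module E = OrderEmbedding σ (deleteFixed σ) (punchIn a) (Finₚ.punchIn-mono-≤ a) (Finₚ.punchIn-cancel-≤ a)
                 (λ x → sym (punchIn-deleteFixed σ perm fixed x))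
    iter-a : ∀ t → iter σ t a ≡ a
    iter-a zero    = refl
    iter-a (suc t) = trans (cong (lookup σ) (iter-a t)) fixed
    a-leads : leads a ≡ 1
    a-leads = indicator-yes (isCycleLeader? σ a)
      (Equivalence.to (orbitMinimum⇔cycleLeader perm) λ t → ≤-reflexive (cong toℕ (sym (iter-a t))))

  reflectionLength-deleteFixed : ∀ σ → IsPerm σ → lookup σ a ≡ a → reflectionLength σ ≡ reflectionLength (deleteFixed σ)
  reflectionLength-deleteFixed σ perm fixed = cong (suc r ∸_) (cycles-deleteFixed σ perm fixed)

-- Deleting the largest point

module LastPoint {n : ℕ} where

  last : Fin (suc n)
  last = fromℕ n

  ι : Fin n → Fin (suc n)
  ι = punchIn last

  ι≢last : ∀ x → ι x ≢ last
  ι≢last = Finₚ.punchInᵢ≢i last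

  ι-injective : ∀ {x y} → ι x ≡ ι y → x ≡ y
  ι-injective = Finₚ.punchIn-injective last _ _

  last-maximum : ∀ y → toℕ last ≤ toℕ y → y ≡ last
  last-maximum y last≤y = Finₚ.toℕ-injective (≤-antisym (Finₚ.≤fromℕ y) last≤y)

  -- σ with last short-circuited: the predecessor of last is sent to the successor of last.
  bypass : Vec (Fin (suc n)) (suc n) → Fin (suc n) → Fin (suc n)
  bypass σ y with lookup σ y Fin.≟ last
  ... | yes _ = lookup σ last
  ... | no _  = lookup σ y

  bypass-yes : ∀ σ y → lookup σ y ≡ last → bypass σ y ≡ lookup σ last
  bypass-yes σ y σy≡ with lookup σ y Fin.≟ last
  ... | yes _   = refl
  ... | no σy≢  = ⊥-elim (σy≢ σy≡)

  bypass-no : ∀ σ y → lookup σ y ≢ last → bypass σ y ≡ lookup σ y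
  bypass-no σ y σy≢ with lookup σ y Fin.≟ last
  ... | yes σy≡ = ⊥-elim (σy≢ σy≡)
  ... | no _    = refl

  bypass≢last : ∀ σ y → lookup σ last ≢ last → bypass σ y ≢ last
  bypass≢last σ y σlast≢ with lookup σ y Fin.≟ last
  ... | yes _   = σlast≢
  ... | no σy≢  = σy≢

  bypass-injective : ∀ σ → IsPerm σ → ∀ y₁ y₂ → y₁ ≢ last → y₂ ≢ last → bypass σ y₁ ≡ bypass σ y₂ → y₁ ≡ y₂
  bypass-injective σ perm y₁ y₂ y₁≢ y₂≢ eq with lookup σ y₁ Fin.≟ last | lookup σ y₂ Fin.≟ last
  ... | yes σy₁≡ | yes σy₂≡ = perm y₁ y₂ (trans σy₁≡ (sym σy₂≡))
  ... | yes _    | no _     = ⊥-elim (y₂≢ (sym (perm _ _ eq)))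
  ... | no _     | yes _    = ⊥-elim (y₁≢ (perm _ _ eq))
  ... | no _     | no _     = perm y₁ y₂ eq

  deleteLast : Vec (Fin (suc n)) (suc n) → Vec (Fin n) n
  deleteLast σ = tabulate λ x → punchOutOr last (bypass σ (ι x)) x

  ι-deleteLast : ∀ σ → lookup σ last ≢ last → ∀ x → ι (lookup (deleteLast σ) x) ≡ bypass σ (ι x)
  ι-deleteLast σ σlast≢ x = trans (cong ι (Vecₚ.lookup∘tabulate _ x))
    (punchIn-punchOutOr x (λ eq → bypass≢last σ (ι x) σlast≢ (sym eq)))

  -- insertLast j τ, the inverse of deleteLast, puts last between the τ-preimage of j and j.
  rerouted : Fin n → Vec (Fin n) n → Fin n → Fin (suc n)
  rerouted j τ x with lookup τ x Fin.≟ j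
  ... | yes _ = last
  ... | no _  = ι (lookup τ x)

  rerouted-cases : ∀ j τ x →
    (lookup τ x ≡ j × rerouted j τ x ≡ last) ⊎ (lookup τ x ≢ j × rerouted j τ x ≡ ι (lookup τ x))
  rerouted-cases j τ x with lookup τ x Fin.≟ j
  ... | yes τx≡j = inj₁ (τx≡j , refl)
  ... | no τx≢j  = inj₂ (τx≢j , refl)

  inserting : Fin n → Vec (Fin n) n → Fin (suc n) → Fin (suc n)
  inserting j τ y with last Fin.≟ y
  ... | yes _      = ι j
  ... | no last≢y  = rerouted j τ (punchOut last≢y)

  insertLast : Fin n → Vec (Fin n) n → Vec (Fin (suc n)) (suc n)
  insertLast j τ = tabulate (inserting j τ)

  insertLast-last : ∀ j τ → lookup (insertLast j τ) last ≡ ι j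
  insertLast-last j τ = trans (Vecₚ.lookup∘tabulate (inserting j τ) last) inserting-last
    where
    inserting-last : inserting j τ last ≡ ι j
    inserting-last with last Fin.≟ last
    ... | yes _     = refl
    ... | no last≢  = ⊥-elim (last≢ refl)

  insertLast-ι : ∀ j τ x → lookup (insertLast j τ) (ι x) ≡ rerouted j τ x
  insertLast-ι j τ x = trans (Vecₚ.lookup∘tabulate (inserting j τ) (ι x)) inserting-ι
    where
    inserting-ι : inserting j τ (ι x) ≡ rerouted j τ x
    inserting-ι with last Fin.≟ ι x
    ... | yes last≡  = ⊥-elim (ι≢last x (sym last≡))
    ... | no last≢   = cong (rerouted j τ) (ι-injective (Finₚ.punchIn-punchOut last≢))

  insertLast-last≢last : ∀ j τ → lookup (insertLast j τ) last ≢ last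
  insertLast-last≢last j τ eq = ι≢last j (trans (sym (insertLast-last j τ)) eq)

  deleteLast-insertLast : ∀ j τ → deleteLast (insertLast j τ) ≡ τ
  deleteLast-insertLast j τ = vec-ext λ x →
    ι-injective (trans (ι-deleteLast σ (insertLast-last≢last j τ) x) (bypass-ι x))
    where
    σ = insertLast j τ
    bypass-ι : ∀ x → bypass σ (ι x) ≡ ι (lookup τ x)
    bypass-ι x with rerouted-cases j τ x
    ... | inj₁ (τx≡j , to-last) = trans (bypass-yes σ (ι x) (trans (insertLast-ι j τ x) to-last))
                                    (trans (insertLast-last j τ) (cong ι (sym τx≡j)))
    ... | inj₂ (_ , kept)       = trans (bypass-no σ (ι x) (λ σx≡ → ι≢last _ (trans (sym kept)
                                    (trans (sym (insertLast-ι j τ x)) σx≡))))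
                                    (trans (insertLast-ι j τ x) kept)

  insertLast-deleteLast : ∀ σ j → IsPerm σ → ι j ≡ lookup σ last → insertLast j (deleteLast σ) ≡ σ
  insertLast-deleteLast σ j perm ιj≡ = vec-ext pointwise
    where
    τ = deleteLast σ
    σlast≢ : lookup σ last ≢ last
    σlast≢ eq = ι≢last j (trans ιj≡ eq)
    pointwise : ∀ y → lookup (insertLast j τ) y ≡ lookup σ y
    pointwise y with punchIn-view last y
    ... | inj₁ refl = trans (insertLast-last j τ) ιj≡
    ... | inj₂ (x , refl) with lookup σ (ι x) Fin.≟ last | rerouted-cases j τ x
    ...   | yes σx≡ | inj₁ (_ , to-last) = trans (insertLast-ι j τ x) (trans to-last (sym σx≡))
    ...   | yes σx≡ | inj₂ (τx≢j , _)    = ⊥-elim (τx≢j (ι-injective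
            (trans (ι-deleteLast σ σlast≢ x) (trans (bypass-yes σ (ι x) σx≡) (sym ιj≡)))))
    ...   | no σx≢  | inj₁ (τx≡j , _)    = ⊥-elim (ι≢last x (perm _ _
            (trans (sym (bypass-no σ (ι x) σx≢)) (trans (sym (ι-deleteLast σ σlast≢ x)) (trans (cong ι τx≡j) ιj≡)))))
    ...   | no σx≢  | inj₂ (_ , kept)    = trans (insertLast-ι j τ x)
            (trans kept (trans (ι-deleteLast σ σlast≢ x) (bypass-no σ (ι x) σx≢)))

  deleteLast-perm : ∀ σ → IsPerm σ → lookup σ last ≢ last → IsPerm (deleteLast σ)
  deleteLast-perm σ perm σlast≢ x y eq = ι-injective (bypass-injective σ perm (ι x) (ι y) (ι≢last x) (ι≢last y)
    (trans (sym (ι-deleteLast σ σlast≢ x)) (trans (cong ι eq) (ι-deleteLast σ σlast≢ y))))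

  ι≢rerouted : ∀ j τ x → ι j ≢ rerouted j τ x
  ι≢rerouted j τ x eq with rerouted-cases j τ x
  ... | inj₁ (_ , e)    = ι≢last j (trans eq e)
  ... | inj₂ (τx≢j , e) = τx≢j (sym (ι-injective (trans eq e)))

  rerouted-injective : ∀ j τ → IsPerm τ → ∀ x x′ → rerouted j τ x ≡ rerouted j τ x′ → x ≡ x′
  rerouted-injective j τ perm x x′ eq with rerouted-cases j τ x | rerouted-cases j τ x′
  ... | inj₁ (τx≡ , _) | inj₁ (τx′≡ , _) = perm _ _ (trans τx≡ (sym τx′≡))
  ... | inj₁ (_ , e)   | inj₂ (_ , e′)   = ⊥-elim (ι≢last _ (trans (sym e′) (trans (sym eq) e)))
  ... | inj₂ (_ , e)   | inj₁ (_ , e′)   = ⊥-elim (ι≢last _ (trans (sym e) (trans eq e′)))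
  ... | inj₂ (_ , e)   | inj₂ (_ , e′)   = perm _ _ (ι-injective (trans (sym e) (trans eq e′)))

  insertLast-perm : ∀ j τ → IsPerm τ → IsPerm (insertLast j τ)
  insertLast-perm j τ perm y₁ y₂ eq with punchIn-view last y₁ | punchIn-view last y₂
  ... | inj₁ refl       | inj₁ refl        = refl
  ... | inj₁ refl       | inj₂ (x , refl)  =
    ⊥-elim (ι≢rerouted j τ x (trans (sym (insertLast-last j τ)) (trans eq (insertLast-ι j τ x))))
  ... | inj₂ (x , refl) | inj₁ refl        =
    ⊥-elim (ι≢rerouted j τ x (trans (sym (insertLast-last j τ)) (trans (sym eq) (insertLast-ι j τ x))))
  ... | inj₂ (x , refl) | inj₂ (x′ , refl) = cong ι (rerouted-injective j τ perm x x′
    (trans (sym (insertLast-ι j τ x)) (trans eq (insertLast-ι j τ x′))))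

  deleteLast-fixedPoint : ∀ σ → IsDerangement σ → ∀ x → lookup (deleteLast σ) x ≡ x →
    lookup σ last ≡ ι x × lookup σ (ι x) ≡ last
  deleteLast-fixedPoint σ der x fixed with lookup σ (ι x) Fin.≟ last
  ... | yes σx≡ = trans (sym (bypass-yes σ (ι x) σx≡)) bypass≡ , σx≡
    where
    bypass≡ : bypass σ (ι x) ≡ ι x
    bypass≡ = trans (sym (ι-deleteLast σ (der last) x)) (cong ι fixed)
  ... | no σx≢  = ⊥-elim (der (ι x) (trans (sym (bypass-no σ (ι x) σx≢))
                    (trans (sym (ι-deleteLast σ (der last) x)) (cong ι fixed))))

  deleteLast-derangement : ∀ σ → IsDerangement σ → lookup σ (lookup σ last) ≢ last → IsDerangement (deleteLast σ)
  deleteLast-derangement σ der no2cycle x fixed =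
    let σlast≡ , σx≡ = deleteLast-fixedPoint σ der x fixed in no2cycle (trans (cong (lookup σ) σlast≡) σx≡)

  deleteLast-onlyFixed : ∀ σ j → IsDerangement σ → ι j ≡ lookup σ last →
    ∀ x → lookup (deleteLast σ) x ≡ x → x ≡ j
  deleteLast-onlyFixed σ j der ιj≡ x fixed = ι-injective (trans (sym (proj₁ (deleteLast-fixedPoint σ der x fixed))) (sym ιj≡))

  deleteLast-fixes : ∀ σ j → ι j ≡ lookup σ last → lookup σ (lookup σ last) ≡ last → lookup (deleteLast σ) j ≡ j
  deleteLast-fixes σ j ιj≡ 2cycle = ι-injective (trans (ι-deleteLast σ σlast≢ j)
    (trans (bypass-yes σ (ι j) (trans (cong (lookup σ) ιj≡) 2cycle)) (sym ιj≡)))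
    where
    σlast≢ : lookup σ last ≢ last
    σlast≢ eq = ι≢last j (trans ιj≡ eq)

  insertLast-derangement : ∀ j τ → (∀ x → lookup τ x ≡ x → x ≡ j) → IsDerangement (insertLast j τ)
  insertLast-derangement j τ onlyFixed y fixed with punchIn-view last y
  ... | inj₁ refl = insertLast-last≢last j τ fixed
  ... | inj₂ (x , refl) with rerouted-cases j τ x
  ...   | inj₁ (_ , to-last) = ι≢last x (sym (trans (sym to-last) (trans (sym (insertLast-ι j τ x)) fixed)))
  ...   | inj₂ (τx≢j , kept) = τx≢j (trans τx≡x (onlyFixed x τx≡x))
    where
    τx≡x : lookup τ x ≡ x
    τx≡x = ι-injective (trans (sym kept) (trans (sym (insertLast-ι j τ x)) fixed))

  insertLast-2cycle : ∀ j τ → lookup τ j ≡ j → lookup (insertLast j τ) (lookup (insertLast j τ) last) ≡ last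
  insertLast-2cycle j τ τj≡j with rerouted-cases j τ j
  ... | inj₁ (_ , to-last) = trans (cong (lookup (insertLast j τ)) (insertLast-last j τ)) (trans (insertLast-ι j τ j) to-last)
  ... | inj₂ (τj≢j , _)    = ⊥-elim (τj≢j τj≡j)

  insertLast-no2cycle : ∀ j τ → lookup τ j ≢ j → lookup (insertLast j τ) (lookup (insertLast j τ) last) ≢ last
  insertLast-no2cycle j τ τj≢j 2cycle with rerouted-cases j τ j
  ... | inj₁ (τj≡j , _) = τj≢j τj≡j
  ... | inj₂ (_ , kept) = ι≢last _ (trans (sym kept) (trans (sym (insertLast-ι j τ j))
          (trans (cong (lookup (insertLast j τ)) (sym (insertLast-last j τ))) 2cycle)))

  module _ (σ : Vec (Fin (suc n)) (suc n)) (σlast≢ : lookup σ last ≢ last) where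

    private
      τ = deleteLast σ

    deleteLast-step : ∀ y → lookup σ (ι y) ≡ ι (lookup τ y) ⊎ (lookup σ (ι y) ≡ last × lookup σ last ≡ ι (lookup τ y))
    deleteLast-step y with lookup σ (ι y) Fin.≟ last
    ... | yes σy≡ = inj₂ (σy≡ , sym (trans (ι-deleteLast σ σlast≢ y) (bypass-yes σ (ι y) σy≡)))
    ... | no σy≢  = inj₁ (sym (trans (ι-deleteLast σ σlast≢ y) (bypass-no σ (ι y) σy≢)))

    iter-σ-within-τ : ∀ x t → ∃[ t′ ] (iter σ t (ι x) ≡ ι (iter τ t′ x)
      ⊎ (iter σ t (ι x) ≡ last × lookup σ last ≡ ι (iter τ t′ x)))
    iter-σ-within-τ x zero = 0 , inj₁ refl
    iter-σ-within-τ x (suc t) with iter-σ-within-τ x t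
    ... | t′ , inj₂ (at-last , next) = t′ , inj₁ (trans (cong (lookup σ) at-last) next)
    ... | t′ , inj₁ at with deleteLast-step (iter τ t′ x)
    ...   | inj₁ next              = suc t′ , inj₁ (trans (cong (lookup σ) at) next)
    ...   | inj₂ (to-last , next)  = suc t′ , inj₂ (trans (cong (lookup σ) at) to-last , next)

    iter-τ-within-σ : ∀ x t′ → ∃[ t ] iter σ t (ι x) ≡ ι (iter τ t′ x)
    iter-τ-within-σ x zero = 0 , refl
    iter-τ-within-σ x (suc t′) with iter-τ-within-σ x t′
    ... | t , at with deleteLast-step (iter τ t′ x)
    ...   | inj₁ next             = suc t , trans (cong (lookup σ) at) next
    ...   | inj₂ (to-last , next) = suc (suc t) , trans (cong (lookup σ ∘ lookup σ) at) (trans (cong (lookup σ) to-last) next)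

    orbitMinimum-ι : ∀ x → IsOrbitMinimum σ (ι x) ⇔ IsOrbitMinimum τ x
    orbitMinimum-ι x = mk⇔ σ-min⇒τ-min τ-min⇒σ-min
      where
      σ-min⇒τ-min : IsOrbitMinimum σ (ι x) → IsOrbitMinimum τ x
      σ-min⇒τ-min min t′ = let t , at = iter-τ-within-σ x t′ in
        Finₚ.punchIn-cancel-≤ last x _ (subst (λ y → toℕ (ι x) ≤ toℕ y) at (min t))
      τ-min⇒σ-min : IsOrbitMinimum τ x → IsOrbitMinimum σ (ι x)
      τ-min⇒σ-min min t with iter-σ-within-τ x t
      ... | t′ , inj₁ at            = subst (λ y → toℕ (ι x) ≤ toℕ y) (sym at) (Finₚ.punchIn-mono-≤ last x _ (min t′))
      ... | t′ , inj₂ (at-last , _) = subst (λ y → toℕ (ι x) ≤ toℕ y) (sym at-last) (Finₚ.≤fromℕ (ι x))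

    cycles-deleteLast : IsPerm σ → cycles σ ≡ cycles τ
    cycles-deleteLast perm = begin
      cycles σ                      ≡⟨ cycles≡sum σ ⟩
      sum leads                     ≡⟨ sum-remove {i = last} leads ⟩
      leads last + sum (leads ∘ ι)  ≡⟨ cong₂ _+_ last-leads-not
                                       (cycles-transfer ι perm (deleteLast-perm σ perm σlast≢) orbitMinimum-ι) ⟩
      cycles τ                      ∎
      where
      open ≡-Reasoning
      leads : Fin (suc n) → ℕ
      leads y = indicator (isCycleLeader? σ y)
      last-leads-not : leads last ≡ 0
      last-leads-not = indicator-no (isCycleLeader? σ last) λ leader → σlast≢ (last-maximum _ (leader zero))

    reflectionLength-deleteLast : IsPerm σ → reflectionLength σ ≡ suc (reflectionLength τ)
    reflectionLength-deleteLast perm = trans (cong (suc n ∸_) (cycles-deleteLast perm)) (+-∸-assoc 1 (cycles≤ τ))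

bit : Bool → ℕ
bit false = 0
bit true  = 1

parity-suc : ∀ b {x y} → x ≡ suc y → x % 2 ≡ bit b ⇔ y % 2 ≡ bit (not b)
parity-suc b {y = y} refl = mk⇔ (to b y) (from b y)
  where
  to : ∀ b y → suc y % 2 ≡ bit b → y % 2 ≡ bit (not b)
  to false zero          ()
  to true  zero          _  = refl
  to false (suc zero)    _  = refl
  to true  (suc zero)    ()
  to b     (suc (suc y))    = to b y
  from : ∀ b y → y % 2 ≡ bit (not b) → suc y % 2 ≡ bit b
  from false zero          ()
  from true  zero          _  = refl
  from false (suc zero)    _  = refl
  from true  (suc zero)    ()
  from b     (suc (suc y))    = from b y

parity-+ : ∀ c x y → (x + y) % 2 ≡ bit c ⇔
  ((x % 2 ≡ bit false × y % 2 ≡ bit c) ⊎ (x % 2 ≡ bit true × y % 2 ≡ bit (not c)))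
parity-+ c zero y = mk⇔ (λ y%2 → inj₁ (refl , y%2)) λ { (inj₁ (_ , y%2)) → y%2 ; (inj₂ (() , _)) }
parity-+ c (suc zero) y = mk⇔ (λ 1+y%2 → inj₂ (refl , Equivalence.to (parity-suc c {y = y} refl) 1+y%2))
  λ { (inj₁ (() , _)) ; (inj₂ (_ , y%2)) → Equivalence.from (parity-suc c {y = y} refl) y%2 }
parity-+ c (suc (suc x)) y = parity-+ c x y

isDerangement? : ∀ {n} → Decidable (IsDerangement {n})
isDerangement? v = Finₚ.all? λ i → ¬? (lookup v i Fin.≟ i)

SignedDerangement : Bool → ∀ {n} → Vec (Fin n) n → Set
SignedDerangement b v = IsDerangement v × reflectionLength v % 2 ≡ bit b

signedDerangement? : ∀ b {n} → Decidable (SignedDerangement b {n})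
signedDerangement? b v = isDerangement? v ×-dec (reflectionLength v % 2 ≟ bit b)

derangements : Bool → ℕ → ℕ
derangements b n = count (signedDerangement? b {n}) (perms n)

-- σ ↦ (j , τ) with j the successor of the last point; τ deletes the last point, and also j when the two
-- form a 2-cycle. In both cases the sign changes.
module Recurrence (r : ℕ) (b : Bool) where
  open LastPoint {suc r}
  open FixedPoint using (insertFixed; deleteFixed)

  Reduced : Set
  Reduced = Vec (Fin (suc r)) (suc r) ⊎ Vec (Fin r) r

  successor : Vec (Fin (suc (suc r))) (suc (suc r)) → Fin (suc r)
  successor σ = punchOutOr last (lookup σ last) zero

  ι-successor : ∀ σ → lookup σ last ≢ last → ι (successor σ) ≡ lookup σ last
  ι-successor σ σlast≢ = punchIn-punchOutOr zero (σlast≢ ∘ sym)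

  successor-insertLast : ∀ j τ → successor (insertLast j τ) ≡ j
  successor-insertLast j τ = trans (cong (λ y → punchOutOr last y zero) (insertLast-last j τ)) (punchOutOr-punchIn last j zero)

  InTwoCycle : Vec (Fin (suc (suc r))) (suc (suc r)) → Set
  InTwoCycle σ = lookup σ (lookup σ last) ≡ last

  reduce : ∀ σ → Dec (InTwoCycle σ) → Reduced
  reduce σ (yes _) = inj₂ (deleteFixed (successor σ) (deleteLast σ))
  reduce σ (no _)  = inj₁ (deleteLast σ)

  decompose : Vec (Fin (suc (suc r))) (suc (suc r)) → Fin (suc r) × Reduced
  decompose σ = successor σ , reduce σ (lookup σ (lookup σ last) Fin.≟ last)

  compose : Fin (suc r) × Reduced → Vec (Fin (suc (suc r))) (suc (suc r))
  compose (j , inj₁ τ) = insertLast j τ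
  compose (j , inj₂ τ) = insertLast j (insertFixed j τ)

  Target : Fin (suc r) × Reduced → Set
  Target (_ , ρ) = ⊤ × [ SignedDerangement (not b) , SignedDerangement (not b) ] ρ

  target? : Decidable Target
  target? = (λ _ → yes tt) ×? (signedDerangement? (not b) ⊎? signedDerangement? (not b))

  targets : List (Fin (suc r) × Reduced)
  targets = cartesianProduct (allFin (suc r)) (perms (suc r) ⊎ˡ perms r)

  deleteLast-signed : ∀ σ → IsPerm σ → SignedDerangement b σ → ¬ InTwoCycle σ →
    IsPerm (deleteLast σ) × SignedDerangement (not b) (deleteLast σ)
  deleteLast-signed σ perm (der , sign) no2cycle =
    deleteLast-perm σ perm (der last) ,
    deleteLast-derangement σ der no2cycle ,
    Equivalence.to (parity-suc b (reflectionLength-deleteLast σ (der last) perm)) sign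

  deleteTwoCycle-signed : ∀ σ → IsPerm σ → SignedDerangement b σ → InTwoCycle σ →
    IsPerm (deleteFixed (successor σ) (deleteLast σ)) × SignedDerangement (not b) (deleteFixed (successor σ) (deleteLast σ))
  deleteTwoCycle-signed σ perm (der , sign) 2cycle =
    FixedPoint.deleteFixed-perm j τ perm-τ fixed ,
    FixedPoint.deleteFixed-derangement j τ perm-τ fixed (deleteLast-onlyFixed σ j der ιj≡) ,
    Equivalence.to (parity-suc b (trans (reflectionLength-deleteLast σ (der last) perm)
      (cong suc (FixedPoint.reflectionLength-deleteFixed j τ perm-τ fixed)))) sign
    where
    j = successor σ
    τ = deleteLast σ
    ιj≡ = ι-successor σ (der last)
    perm-τ = deleteLast-perm σ perm (der last)
    fixed = deleteLast-fixes σ j ιj≡ 2cycle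

  insertLast-signed : ∀ j τ → IsPerm τ → SignedDerangement (not b) τ →
    IsPerm (insertLast j τ) × SignedDerangement b (insertLast j τ)
  insertLast-signed j τ perm (der , sign) =
    insertLast-perm j τ perm ,
    insertLast-derangement j τ (λ x fixed → ⊥-elim (der x fixed)) ,
    Equivalence.from (parity-suc b (trans (reflectionLength-deleteLast σ (insertLast-last≢last j τ) (insertLast-perm j τ perm))
      (cong (λ v → suc (reflectionLength v)) (deleteLast-insertLast j τ)))) sign
    where
    σ = insertLast j τ

  insertTwoCycle-signed : ∀ j τ → IsPerm τ → SignedDerangement (not b) τ →
    IsPerm (insertLast j (insertFixed j τ)) × SignedDerangement b (insertLast j (insertFixed j τ))
  insertTwoCycle-signed j τ perm (der , sign) =
    perm-σ ,
    insertLast-derangement j τ′ (FixedPoint.insertFixed-onlyFixed j τ der) ,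
    Equivalence.from (parity-suc b (begin
      reflectionLength σ
        ≡⟨ reflectionLength-deleteLast σ (insertLast-last≢last j τ′) perm-σ ⟩
      suc (reflectionLength (deleteLast σ))
        ≡⟨ cong (λ v → suc (reflectionLength v)) (deleteLast-insertLast j τ′) ⟩
      suc (reflectionLength τ′)
        ≡⟨ cong suc (FixedPoint.reflectionLength-deleteFixed j τ′ perm-τ′ (FixedPoint.insertFixed-a j τ)) ⟩
      suc (reflectionLength (deleteFixed j τ′))
        ≡⟨ cong (λ v → suc (reflectionLength v)) (FixedPoint.deleteFixed-insertFixed j τ) ⟩
      suc (reflectionLength τ) ∎)) sign
    where
    open ≡-Reasoning
    τ′ = insertFixed j τ
    σ = insertLast j τ′
    perm-τ′ = FixedPoint.insertFixed-perm j τ perm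
    perm-σ = insertLast-perm j τ′ perm-τ′

  decompose-valid : ∀ {σ} → σ ∈ perms (suc (suc r)) → SignedDerangement b σ → decompose σ ∈ targets × Target (decompose σ)
  decompose-valid {σ} σ∈ signed = valid (lookup σ (lookup σ last) Fin.≟ last)
    where
    perm = ∈-perms⁻ σ∈
    valid : ∀ d → (successor σ , reduce σ d) ∈ targets × Target (successor σ , reduce σ d)
    valid (yes 2cycle) = let perm-τ , signed-τ = deleteTwoCycle-signed σ perm signed 2cycle in
      ∈ₚ.∈-cartesianProduct⁺ (∈ₚ.∈-allFin _) (inj₂∈⁺ (∈-perms⁺ perm-τ)) , tt , signed-τ
    valid (no no2cycle) = let perm-τ , signed-τ = deleteLast-signed σ perm signed no2cycle in
      ∈ₚ.∈-cartesianProduct⁺ (∈ₚ.∈-allFin _) (inj₁∈⁺ (∈-perms⁺ perm-τ)) , tt , signed-τ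

  compose-valid : ∀ {jρ} → jρ ∈ targets → Target jρ →
    compose jρ ∈ perms (suc (suc r)) × SignedDerangement b (compose jρ)
  compose-valid {j , ρ} jρ∈ (_ , signed) =
    Product.map₁ ∈-perms⁺ (valid ρ (proj₂ (∈ₚ.∈-cartesianProduct⁻ (allFin (suc r)) _ jρ∈)) signed)
    where
    valid : ∀ ρ → ρ ∈ perms (suc r) ⊎ˡ perms r → [ SignedDerangement (not b) , SignedDerangement (not b) ] ρ →
      IsPerm (compose (j , ρ)) × SignedDerangement b (compose (j , ρ))
    valid (inj₁ τ) τ∈ = insertLast-signed j τ (∈-perms⁻ (inj₁∈⁻ τ∈))
    valid (inj₂ τ) τ∈ = insertTwoCycle-signed j τ (∈-perms⁻ (inj₂∈⁻ {xs = perms (suc r)} τ∈))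

  compose-decompose : ∀ {σ} → σ ∈ perms (suc (suc r)) → SignedDerangement b σ → compose (decompose σ) ≡ σ
  compose-decompose {σ} σ∈ (der , _) = inverse (lookup σ (lookup σ last) Fin.≟ last)
    where
    perm = ∈-perms⁻ σ∈
    ιj≡ = ι-successor σ (der last)
    inverse : ∀ d → compose (successor σ , reduce σ d) ≡ σ
    inverse (yes 2cycle) = trans
      (cong (insertLast (successor σ)) (FixedPoint.insertFixed-deleteFixed (successor σ) (deleteLast σ)
        (deleteLast-perm σ perm (der last)) (deleteLast-fixes σ (successor σ) ιj≡ 2cycle)))
      (insertLast-deleteLast σ (successor σ) perm ιj≡)
    inverse (no _) = insertLast-deleteLast σ (successor σ) perm ιj≡

  decompose-compose : ∀ {jρ} → jρ ∈ targets → Target jρ → decompose (compose jρ) ≡ jρ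
  decompose-compose {j , inj₁ τ} _ (_ , der , _) = cong₂ _,_ (successor-insertLast j τ) (reduce-insertLast _)
    where
    reduce-insertLast : ∀ d → reduce (insertLast j τ) d ≡ inj₁ τ
    reduce-insertLast (yes 2cycle) = ⊥-elim (insertLast-no2cycle j τ (der j) 2cycle)
    reduce-insertLast (no _)       = cong inj₁ (deleteLast-insertLast j τ)
  decompose-compose {j , inj₂ τ} _ (_ , der , _) = cong₂ _,_ (successor-insertLast j τ′) (reduce-insertLast _)
    where
    τ′ = insertFixed j τ
    reduce-insertLast : ∀ d → reduce (insertLast j τ′) d ≡ inj₂ τ
    reduce-insertLast (yes _)        = cong inj₂ (trans (cong₂ deleteFixed (successor-insertLast j τ′) (deleteLast-insertLast j τ′))
                                         (FixedPoint.deleteFixed-insertFixed j τ))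
    reduce-insertLast (no no2cycle)  = ⊥-elim (no2cycle (insertLast-2cycle j τ′ (FixedPoint.insertFixed-a j τ)))

derangements-recurrence : ∀ b r →
  derangements b (suc (suc r)) ≡ suc r * (derangements (not b) (suc r) + derangements (not b) r)
derangements-recurrence b r = begin
  derangements b (suc (suc r))
    ≡⟨ count-bijection (signedDerangement? b) target? (perms-unique _)
         (Uniqueₚ.cartesianProduct⁺ (Uniqueₚ.allFin⁺ (suc r)) (⊎ˡ-unique (perms-unique _) (perms-unique _)))
         decompose compose decompose-valid compose-valid compose-decompose decompose-compose ⟩
  count target? targets
    ≡⟨ count-cartesianProduct (λ _ → yes tt) (signedDerangement? (not b) ⊎? signedDerangement? (not b))
         (allFin (suc r)) (perms (suc r) ⊎ˡ perms r) ⟩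
  count (λ _ → yes tt) (allFin (suc r))
    * count (signedDerangement? (not b) ⊎? signedDerangement? (not b)) (perms (suc r) ⊎ˡ perms r)
    ≡⟨ cong₂ _*_ (trans (count-universal (allFin (suc r))) (Listₚ.length-tabulate {n = suc r} id))
                 (count-⊎ (signedDerangement? (not b)) (signedDerangement? (not b)) (perms (suc r)) (perms r)) ⟩
  suc r * (derangements (not b) (suc r) + derangements (not b) r) ∎
  where
  open ≡-Reasoning
  open Recurrence r b

double : ℕ → ℕ
double zero    = zero
double (suc k) = suc (suc (double k))

double-mono-≤ : ∀ {k l} → k ≤ l → double k ≤ double l
double-mono-≤ z≤n       = z≤n
double-mono-≤ (s≤s k≤l) = s≤s (s≤s (double-mono-≤ k≤l))

double-cancel-≤ : ∀ k l → double k ≤ double l → k ≤ l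
double-cancel-≤ zero    l       _                 = z≤n
double-cancel-≤ (suc k) (suc l) (s≤s (s≤s 2k≤2l)) = s≤s (double-cancel-≤ k l 2k≤2l)

double%2 : ∀ k → double k % 2 ≡ 0
double%2 zero    = refl
double%2 (suc k) = double%2 k

suc-double%2 : ∀ k → suc (double k) % 2 ≡ 1
suc-double%2 zero    = refl
suc-double%2 (suc k) = suc-double%2 k

-- Positions are 0-based: evenIndex x = 2x is the odd position 2x + 1 of [n].
evenIndex : ∀ {n} → Fin ⌈ n /2⌉ → Fin n
evenIndex {suc zero}    zero    = zero
evenIndex {suc (suc n)} zero    = zero
evenIndex {suc (suc n)} (suc x) = suc (suc (evenIndex x))

oddIndex : ∀ {n} → Fin ⌊ n /2⌋ → Fin n
oddIndex {suc (suc n)} zero    = suc zero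
oddIndex {suc (suc n)} (suc x) = suc (suc (oddIndex x))

splitParity : ∀ {n} → Fin n → Fin ⌈ n /2⌉ ⊎ Fin ⌊ n /2⌋
splitParity {suc zero}    zero          = inj₁ zero
splitParity {suc (suc n)} zero          = inj₁ zero
splitParity {suc (suc n)} (suc zero)    = inj₂ zero
splitParity {suc (suc n)} (suc (suc y)) = Sum.map suc suc (splitParity {n} y)

toℕ-evenIndex : ∀ {n} (x : Fin ⌈ n /2⌉) → toℕ (evenIndex {n} x) ≡ double (toℕ x)
toℕ-evenIndex {suc zero}    zero    = refl
toℕ-evenIndex {suc (suc n)} zero    = refl
toℕ-evenIndex {suc (suc n)} (suc x) = cong (λ k → suc (suc k)) (toℕ-evenIndex {n} x)

toℕ-oddIndex : ∀ {n} (x : Fin ⌊ n /2⌋) → toℕ (oddIndex {n} x) ≡ suc (double (toℕ x))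
toℕ-oddIndex {suc (suc n)} zero    = refl
toℕ-oddIndex {suc (suc n)} (suc x) = cong (λ k → suc (suc k)) (toℕ-oddIndex {n} x)

splitParity-evenIndex : ∀ {n} (x : Fin ⌈ n /2⌉) → splitParity {n} (evenIndex x) ≡ inj₁ x
splitParity-evenIndex {suc zero}    zero    = refl
splitParity-evenIndex {suc (suc n)} zero    = refl
splitParity-evenIndex {suc (suc n)} (suc x) = cong (Sum.map suc suc) (splitParity-evenIndex {n} x)

splitParity-oddIndex : ∀ {n} (x : Fin ⌊ n /2⌋) → splitParity {n} (oddIndex x) ≡ inj₂ x
splitParity-oddIndex {suc (suc n)} zero    = refl
splitParity-oddIndex {suc (suc n)} (suc x) = cong (Sum.map suc suc) (splitParity-oddIndex {n} x)

data ParityView {n} : Fin n → Set where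
  even : ∀ x → ParityView (evenIndex x)
  odd  : ∀ x → ParityView (oddIndex x)

parityView : ∀ {n} (y : Fin n) → ParityView y
parityView {suc zero}    zero          = even zero
parityView {suc (suc n)} zero          = even zero
parityView {suc (suc n)} (suc zero)    = odd zero
parityView {suc (suc n)} (suc (suc y)) with parityView {n} y
... | even x = even (suc x)
... | odd x  = odd (suc x)

evenIndex-injective : ∀ {n} {x y : Fin ⌈ n /2⌉} → evenIndex {n} x ≡ evenIndex y → x ≡ y
evenIndex-injective {n} {x} {y} eq = Sumₚ.inj₁-injective
  (trans (sym (splitParity-evenIndex {n} x)) (trans (cong splitParity eq) (splitParity-evenIndex y)))

oddIndex-injective : ∀ {n} {x y : Fin ⌊ n /2⌋} → oddIndex {n} x ≡ oddIndex y → x ≡ y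
oddIndex-injective {n} {x} {y} eq = Sumₚ.inj₂-injective
  (trans (sym (splitParity-oddIndex {n} x)) (trans (cong splitParity eq) (splitParity-oddIndex y)))

evenIndex≢oddIndex : ∀ {n} (x : Fin ⌈ n /2⌉) (y : Fin ⌊ n /2⌋) → evenIndex x ≢ oddIndex y
evenIndex≢oddIndex {n} x y eq with trans (sym (splitParity-evenIndex {n} x)) (trans (cong splitParity eq) (splitParity-oddIndex y))
... | ()

evenIndex%2 : ∀ {n} (x : Fin ⌈ n /2⌉) → toℕ (evenIndex {n} x) % 2 ≡ 0
evenIndex%2 {n} x = trans (cong (_% 2) (toℕ-evenIndex {n} x)) (double%2 (toℕ x))

oddIndex%2 : ∀ {n} (x : Fin ⌊ n /2⌋) → toℕ (oddIndex {n} x) % 2 ≡ 1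
oddIndex%2 {n} x = trans (cong (_% 2) (toℕ-oddIndex {n} x)) (suc-double%2 (toℕ x))

evenIndex-mono-≤ : ∀ {n} (x y : Fin ⌈ n /2⌉) → toℕ x ≤ toℕ y → toℕ (evenIndex {n} x) ≤ toℕ (evenIndex {n} y)
evenIndex-mono-≤ {n} x y x≤y =
  subst₂ _≤_ (sym (toℕ-evenIndex {n} x)) (sym (toℕ-evenIndex {n} y)) (double-mono-≤ x≤y)

evenIndex-cancel-≤ : ∀ {n} (x y : Fin ⌈ n /2⌉) →
  toℕ (evenIndex {n} x) ≤ toℕ (evenIndex {n} y) → toℕ x ≤ toℕ y
evenIndex-cancel-≤ {n} x y ≤ = double-cancel-≤ _ _ (subst₂ _≤_ (toℕ-evenIndex {n} x) (toℕ-evenIndex {n} y) ≤)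

oddIndex-mono-≤ : ∀ {n} (x y : Fin ⌊ n /2⌋) → toℕ x ≤ toℕ y → toℕ (oddIndex {n} x) ≤ toℕ (oddIndex {n} y)
oddIndex-mono-≤ {n} x y x≤y =
  subst₂ _≤_ (sym (toℕ-oddIndex {n} x)) (sym (toℕ-oddIndex {n} y)) (s≤s (double-mono-≤ x≤y))

oddIndex-cancel-≤ : ∀ {n} (x y : Fin ⌊ n /2⌋) →
  toℕ (oddIndex {n} x) ≤ toℕ (oddIndex {n} y) → toℕ x ≤ toℕ y
oddIndex-cancel-≤ {n} x y ≤ with subst₂ _≤_ (toℕ-oddIndex {n} x) (toℕ-oddIndex {n} y) ≤
... | s≤s 2x≤2y = double-cancel-≤ _ _ 2x≤2y

sum-evenIndex-oddIndex : ∀ {n} (f : Fin n → ℕ) → sum f ≡ sum (f ∘ evenIndex) + sum (f ∘ oddIndex)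
sum-evenIndex-oddIndex {zero}        f = refl
sum-evenIndex-oddIndex {suc zero}    f = sym (+-identityʳ _)
sum-evenIndex-oddIndex {suc (suc n)} f =
  trans (cong (λ s → f zero + (f (suc zero) + s)) (sum-evenIndex-oddIndex {n} (λ y → f (suc (suc y)))))
        (trans (sym (+-assoc (f zero) (f (suc zero)) _)) (interchange (f zero) (f (suc zero)) _ _))

-- Splitting a PAP by the parity of positions

[m+n]∸[o+p]≡[m∸o]+[n∸p] : ∀ {m n o p} → o ≤ m → p ≤ n → (m + n) ∸ (o + p) ≡ (m ∸ o) + (n ∸ p)
[m+n]∸[o+p]≡[m∸o]+[n∸p] {m} z≤n     p≤n = +-∸-assoc m p≤n
[m+n]∸[o+p]≡[m∸o]+[n∸p]     (s≤s o≤m) p≤n = [m+n]∸[o+p]≡[m∸o]+[n∸p] o≤m p≤n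

module ParitySplit (n : ℕ) where

  restrictEven : Vec (Fin n) n → Vec (Fin ⌈ n /2⌉) ⌈ n /2⌉
  restrictEven σ = tabulate λ x → [ id , (λ _ → x) ] (splitParity (lookup σ (evenIndex x)))

  restrictOdd : Vec (Fin n) n → Vec (Fin ⌊ n /2⌋) ⌊ n /2⌋
  restrictOdd σ = tabulate λ x → [ (λ _ → x) , id ] (splitParity (lookup σ (oddIndex x)))

  merge : Vec (Fin ⌈ n /2⌉) ⌈ n /2⌉ → Vec (Fin ⌊ n /2⌋) ⌊ n /2⌋ → Vec (Fin n) n
  merge α β = tabulate λ y → [ evenIndex ∘ lookup α , oddIndex ∘ lookup β ] (splitParity y)

  merge-evenIndex : ∀ α β x → lookup (merge α β) (evenIndex x) ≡ evenIndex (lookup α x)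
  merge-evenIndex α β x = trans (Vecₚ.lookup∘tabulate _ (evenIndex x))
    (cong [ evenIndex ∘ lookup α , oddIndex ∘ lookup β ] (splitParity-evenIndex {n} x))

  merge-oddIndex : ∀ α β x → lookup (merge α β) (oddIndex x) ≡ oddIndex (lookup β x)
  merge-oddIndex α β x = trans (Vecₚ.lookup∘tabulate _ (oddIndex x))
    (cong [ evenIndex ∘ lookup α , oddIndex ∘ lookup β ] (splitParity-oddIndex {n} x))

  σ-evenIndex : ∀ σ → IsPAP σ → ∀ x → lookup σ (evenIndex x) ≡ evenIndex (lookup (restrictEven σ) x)
  σ-evenIndex σ pap x with lookup σ (evenIndex x) | pap (evenIndex x) | Vecₚ.lookup∘tabulate
    (λ x → [ id , (λ _ → x) ] (splitParity (lookup σ (evenIndex x)))) x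
  ... | y | y%2≡ | restrict≡ with parityView y
  ...   | even z = cong evenIndex (sym (trans restrict≡ (cong [ id , (λ _ → x) ] (splitParity-evenIndex {n} z))))
  ...   | odd z  = ⊥-elim (0≢1+n (trans (sym (evenIndex%2 {n} x)) (trans (sym y%2≡) (oddIndex%2 {n} z))))

  σ-oddIndex : ∀ σ → IsPAP σ → ∀ x → lookup σ (oddIndex x) ≡ oddIndex (lookup (restrictOdd σ) x)
  σ-oddIndex σ pap x with lookup σ (oddIndex x) | pap (oddIndex x) | Vecₚ.lookup∘tabulate
    (λ x → [ (λ _ → x) , id ] (splitParity (lookup σ (oddIndex x)))) x
  ... | y | y%2≡ | restrict≡ with parityView y
  ...   | odd z  = cong oddIndex (sym (trans restrict≡ (cong [ (λ _ → x) , id ] (splitParity-oddIndex {n} z))))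
  ...   | even z = ⊥-elim (0≢1+n (trans (sym (evenIndex%2 {n} z)) (trans y%2≡ (oddIndex%2 {n} x))))

  restrictEven-merge : ∀ α β → restrictEven (merge α β) ≡ α
  restrictEven-merge α β = vec-ext λ x → trans (Vecₚ.lookup∘tabulate _ x)
    (cong [ id , (λ _ → x) ] (trans (cong splitParity (merge-evenIndex α β x)) (splitParity-evenIndex {n} _)))

  restrictOdd-merge : ∀ α β → restrictOdd (merge α β) ≡ β
  restrictOdd-merge α β = vec-ext λ x → trans (Vecₚ.lookup∘tabulate _ x)
    (cong [ (λ _ → x) , id ] (trans (cong splitParity (merge-oddIndex α β x)) (splitParity-oddIndex {n} _)))

  merge-restrict : ∀ σ → IsPAP σ → merge (restrictEven σ) (restrictOdd σ) ≡ σ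
  merge-restrict σ pap = vec-ext pointwise
    where
    pointwise : ∀ y → lookup (merge (restrictEven σ) (restrictOdd σ)) y ≡ lookup σ y
    pointwise y with parityView y
    ... | even x = trans (merge-evenIndex (restrictEven σ) (restrictOdd σ) x) (sym (σ-evenIndex σ pap x))
    ... | odd x  = trans (merge-oddIndex (restrictEven σ) (restrictOdd σ) x) (sym (σ-oddIndex σ pap x))

  merge-pap : ∀ α β → IsPAP (merge α β)
  merge-pap α β y with parityView y
  ... | even x = trans (cong (λ z → toℕ z % 2) (merge-evenIndex α β x)) (trans (evenIndex%2 {n} _) (sym (evenIndex%2 {n} x)))
  ... | odd x  = trans (cong (λ z → toℕ z % 2) (merge-oddIndex α β x)) (trans (oddIndex%2 {n} _) (sym (oddIndex%2 {n} x)))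

  merge-perm : ∀ α β → IsPerm α → IsPerm β → IsPerm (merge α β)
  merge-perm α β perm-α perm-β y₁ y₂ eq with parityView y₁ | parityView y₂
  ... | even x | even x′ = cong evenIndex (perm-α _ _ (evenIndex-injective {n}
          (trans (sym (merge-evenIndex α β x)) (trans eq (merge-evenIndex α β x′)))))
  ... | even x | odd x′  = ⊥-elim (evenIndex≢oddIndex _ _
          (trans (sym (merge-evenIndex α β x)) (trans eq (merge-oddIndex α β x′))))
  ... | odd x  | even x′ = ⊥-elim (evenIndex≢oddIndex _ _
          (trans (sym (merge-evenIndex α β x′)) (trans (sym eq) (merge-oddIndex α β x))))
  ... | odd x  | odd x′  = cong oddIndex (perm-β _ _ (oddIndex-injective {n}
          (trans (sym (merge-oddIndex α β x)) (trans eq (merge-oddIndex α β x′)))))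

  merge-derangement : ∀ α β → IsDerangement α → IsDerangement β → IsDerangement (merge α β)
  merge-derangement α β der-α der-β y fixed with parityView y
  ... | even x = der-α x (evenIndex-injective {n} (trans (sym (merge-evenIndex α β x)) fixed))
  ... | odd x  = der-β x (oddIndex-injective {n} (trans (sym (merge-oddIndex α β x)) fixed))

  restrictEven-perm : ∀ σ → IsPAP σ → IsPerm σ → IsPerm (restrictEven σ)
  restrictEven-perm σ pap perm x y eq = evenIndex-injective {n}
    (perm _ _ (trans (σ-evenIndex σ pap x) (trans (cong evenIndex eq) (sym (σ-evenIndex σ pap y)))))

  restrictOdd-perm : ∀ σ → IsPAP σ → IsPerm σ → IsPerm (restrictOdd σ)
  restrictOdd-perm σ pap perm x y eq = oddIndex-injective {n}
    (perm _ _ (trans (σ-oddIndex σ pap x) (trans (cong oddIndex eq) (sym (σ-oddIndex σ pap y)))))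

  restrictEven-derangement : ∀ σ → IsPAP σ → IsDerangement σ → IsDerangement (restrictEven σ)
  restrictEven-derangement σ pap der x fixed = der (evenIndex x) (trans (σ-evenIndex σ pap x) (cong evenIndex fixed))

  restrictOdd-derangement : ∀ σ → IsPAP σ → IsDerangement σ → IsDerangement (restrictOdd σ)
  restrictOdd-derangement σ pap der x fixed = der (oddIndex x) (trans (σ-oddIndex σ pap x) (cong oddIndex fixed))

  cycles-restrict : ∀ σ → IsPAP σ → IsPerm σ → cycles σ ≡ cycles (restrictEven σ) + cycles (restrictOdd σ)
  cycles-restrict σ pap perm = begin
    cycles σ                                          ≡⟨ cycles≡sum σ ⟩
    sum leads                                         ≡⟨ sum-evenIndex-oddIndex leads ⟩
    sum (leads ∘ evenIndex) + sum (leads ∘ oddIndex)  ≡⟨ cong₂ _+_ (Even.cycles-embedded perm (restrictEven-perm σ pap perm))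
                                                                     (Odd.cycles-embedded perm (restrictOdd-perm σ pap perm)) ⟩
    cycles (restrictEven σ) + cycles (restrictOdd σ)  ∎
    where
    open ≡-Reasoning
    leads : Fin n → ℕ
    leads y = indicator (isCycleLeader? σ y)
    module Even = OrderEmbedding σ (restrictEven σ) evenIndex
                    (evenIndex-mono-≤ {n}) (evenIndex-cancel-≤ {n}) (σ-evenIndex σ pap)
    module Odd  = OrderEmbedding σ (restrictOdd σ) oddIndex
                    (oddIndex-mono-≤ {n}) (oddIndex-cancel-≤ {n}) (σ-oddIndex σ pap)

  reflectionLength-restrict : ∀ σ → IsPAP σ → IsPerm σ →
    reflectionLength σ ≡ reflectionLength (restrictEven σ) + reflectionLength (restrictOdd σ)
  reflectionLength-restrict σ pap perm = trans
    (cong₂ _∸_ (trans (sym (⌊n/2⌋+⌈n/2⌉≡n n)) (+-comm ⌊ n /2⌋ ⌈ n /2⌉)) (cycles-restrict σ pap perm))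
    ([m+n]∸[o+p]≡[m∸o]+[n∸p] (cycles≤ (restrictEven σ)) (cycles≤ (restrictOdd σ)))

SignedPAD : Bool → ∀ {n} → Vec (Fin n) n → Set
SignedPAD c v = IsPAD v × reflectionLength v % 2 ≡ bit c

module PADCount (n : ℕ) (c : Bool) (signedPAD? : Decidable (SignedPAD c {n})) where
  open ParitySplit n

  Pair : Set
  Pair = Vec (Fin ⌈ n /2⌉) ⌈ n /2⌉ × Vec (Fin ⌊ n /2⌋) ⌊ n /2⌋

  SignedPair : Pair → Set
  SignedPair (α , β) = IsDerangement α × IsDerangement β × (reflectionLength α + reflectionLength β) % 2 ≡ bit c

  signedPair? : Decidable SignedPair
  signedPair? (α , β) =
    isDerangement? α ×-dec isDerangement? β ×-dec ((reflectionLength α + reflectionLength β) % 2 ≟ bit c)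

  pairs : List Pair
  pairs = cartesianProduct (perms ⌈ n /2⌉) (perms ⌊ n /2⌋)

  restrict : Vec (Fin n) n → Pair
  restrict σ = restrictEven σ , restrictOdd σ

  merge′ : Pair → Vec (Fin n) n
  merge′ (α , β) = merge α β

  restrict-valid : ∀ {σ} → σ ∈ perms n → SignedPAD c σ → restrict σ ∈ pairs × SignedPair (restrict σ)
  restrict-valid {σ} σ∈ ((pap , der) , sign) =
    ∈ₚ.∈-cartesianProduct⁺ (∈-perms⁺ (restrictEven-perm σ pap perm)) (∈-perms⁺ (restrictOdd-perm σ pap perm)) ,
    restrictEven-derangement σ pap der , restrictOdd-derangement σ pap der ,
    subst (λ l → l % 2 ≡ bit c) (reflectionLength-restrict σ pap perm) sign
    where
    perm = ∈-perms⁻ σ∈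

  merge-valid : ∀ {p} → p ∈ pairs → SignedPair p → merge′ p ∈ perms n × SignedPAD c (merge′ p)
  merge-valid {α , β} p∈ (der-α , der-β , sign) =
    ∈-perms⁺ perm , (merge-pap α β , merge-derangement α β der-α der-β) ,
    subst (λ l → l % 2 ≡ bit c) (sym (begin
      reflectionLength (merge α β)
        ≡⟨ reflectionLength-restrict (merge α β) (merge-pap α β) perm ⟩
      reflectionLength (restrictEven (merge α β)) + reflectionLength (restrictOdd (merge α β))
        ≡⟨ cong₂ (λ α′ β′ → reflectionLength α′ + reflectionLength β′) (restrictEven-merge α β) (restrictOdd-merge α β) ⟩
      reflectionLength α + reflectionLength β ∎)) sign
    where
    open ≡-Reasoning
    α∈×β∈ = ∈ₚ.∈-cartesianProduct⁻ (perms ⌈ n /2⌉) (perms ⌊ n /2⌋) p∈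
    perm = merge-perm α β (∈-perms⁻ (proj₁ α∈×β∈)) (∈-perms⁻ (proj₂ α∈×β∈))

  signedPair⇔ : ∀ p → SignedPair p ⇔
    ((SignedDerangement false (proj₁ p) × SignedDerangement c (proj₂ p)) ⊎
     (SignedDerangement true (proj₁ p) × SignedDerangement (not c) (proj₂ p)))
  signedPair⇔ (α , β) = mk⇔
    (λ (der-α , der-β , sign) → Sum.map (λ (a , b) → (der-α , a) , (der-β , b)) (λ (a , b) → (der-α , a) , (der-β , b))
      (Equivalence.to parity sign))
    [ (λ ((der-α , a) , (der-β , b)) → der-α , der-β , Equivalence.from parity (inj₁ (a , b)))
    , (λ ((der-α , a) , (der-β , b)) → der-α , der-β , Equivalence.from parity (inj₂ (a , b))) ]
    where
    parity = parity-+ c (reflectionLength α) (reflectionLength β)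

  signedPAD-count : count signedPAD? (perms n) ≡
    derangements false ⌈ n /2⌉ * derangements c ⌊ n /2⌋ + derangements true ⌈ n /2⌉ * derangements (not c) ⌊ n /2⌋
  signedPAD-count = begin
    count signedPAD? (perms n)
      ≡⟨ count-bijection signedPAD? signedPair? (perms-unique n)
           (Uniqueₚ.cartesianProduct⁺ (perms-unique ⌈ n /2⌉) (perms-unique ⌊ n /2⌋))
           restrict merge′ restrict-valid merge-valid
           (λ {σ} _ ((pap , _) , _) → merge-restrict σ pap)
           (λ {p} _ _ → cong₂ _,_ (restrictEven-merge (proj₁ p) (proj₂ p)) (restrictOdd-merge (proj₁ p) (proj₂ p))) ⟩
    count signedPair? pairs
      ≡⟨ count-disjoint-∪ signedPair? (sd false ×? sd c) (sd true ×? sd (not c)) signedPair⇔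
           (λ _ ((_ , α-even) , _) ((_ , α-odd) , _) → 0≢1+n (trans (sym α-even) α-odd)) pairs ⟩
    count (sd false ×? sd c) pairs + count (sd true ×? sd (not c)) pairs
      ≡⟨ cong₂ _+_ (count-cartesianProduct (sd false) (sd c) (perms ⌈ n /2⌉) (perms ⌊ n /2⌋))
                   (count-cartesianProduct (sd true) (sd (not c)) (perms ⌈ n /2⌉) (perms ⌊ n /2⌋)) ⟩
    derangements false ⌈ n /2⌉ * derangements c ⌊ n /2⌋ + derangements true ⌈ n /2⌉ * derangements (not c) ⌊ n /2⌋ ∎
    where
    open ≡-Reasoning
    sd : ∀ b {m} → Decidable (SignedDerangement b {m})
    sd = signedDerangement?

dE-split : ∀ n →
  dE n ≡ derangements false ⌈ n /2⌉ * derangements false ⌊ n /2⌋ + derangements true ⌈ n /2⌉ * derangements true ⌊ n /2⌋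
dE-split n = PADCount.signedPAD-count n false isEvenPAD?

dO-split : ∀ n →
  dO n ≡ derangements false ⌈ n /2⌉ * derangements true ⌊ n /2⌋ + derangements true ⌈ n /2⌉ * derangements false ⌊ n /2⌋
dO-split n = PADCount.signedPAD-count n true isOddPAD?

RecurrenceAt : (ℕ → ℕ) → (ℕ → ℕ) → ℕ → Set
RecurrenceAt x y n = x n ≡ ((n ∸ 1) / 2) * (y (n ∸ 1) + (n ∸ 2 ∸ (n ∸ 1) / 2) * (x (n ∸ 3) + x (n ∸ 4)))

RecurrenceAt-cong : ∀ {x x′ y y′ : ℕ → ℕ} → (∀ m → x m ≡ x′ m) → (∀ m → y m ≡ y′ m) →
  ∀ n → RecurrenceAt x′ y′ n → RecurrenceAt x y n
RecurrenceAt-cong {x} {x′} {y} {y′} x≗x′ y≗y′ n rec = trans (x≗x′ n) (trans rec (sym (cong₂ (λ a b → s * (a + t * b))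
  (y≗y′ (n ∸ 1)) (cong₂ _+_ (x≗x′ (n ∸ 3)) (x≗x′ (n ∸ 4))))))
  where
  s = (n ∸ 1) / 2
  t = n ∸ 2 ∸ (n ∸ 1) / 2

data Halving : ℕ → Set where
  twice   : ∀ k → Halving (double k)
  twice+1 : ∀ k → Halving (suc (double k))

halving : ∀ m → Halving m
halving zero = twice zero
halving (suc m) with halving m
... | twice k   = twice+1 k
... | twice+1 k = twice (suc k)

⌊double/2⌋ : ∀ k → ⌊ double k /2⌋ ≡ k
⌊double/2⌋ zero    = refl
⌊double/2⌋ (suc k) = cong suc (⌊double/2⌋ k)

⌊suc-double/2⌋ : ∀ k → ⌊ suc (double k) /2⌋ ≡ k
⌊suc-double/2⌋ zero    = refl
⌊suc-double/2⌋ (suc k) = cong suc (⌊suc-double/2⌋ k)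

⌊n/2⌋≡n/2 : ∀ n → ⌊ n /2⌋ ≡ n / 2
⌊n/2⌋≡n/2 zero          = refl
⌊n/2⌋≡n/2 (suc zero)    = refl
⌊n/2⌋≡n/2 (suc (suc n)) = trans (cong suc (⌊n/2⌋≡n/2 n)) (sym (+-distrib-/ 2 n (m%n<n n 2)))

suc-double∸ : ∀ k → suc (double k) ∸ k ≡ suc k
suc-double∸ zero    = refl
suc-double∸ (suc k) = trans (+-∸-assoc 1 (k≤1+2k k)) (cong suc (suc-double∸ k))
  where
  k≤1+2k : ∀ k → k ≤ suc (double k)
  k≤1+2k zero    = z≤n
  k≤1+2k (suc k) = s≤s (m≤n⇒m≤1+n (k≤1+2k k))

factor-scalar₁ : ∀ s a b x y z w → a * (s * (x + y)) + b * (s * (z + w)) ≡ s * ((a * x + b * z) + (a * y + b * w))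
factor-scalar₁ = solve-∀

factor-scalar₂ : ∀ s a b c d x y → s * (a + b) * x + s * (c + d) * y ≡ s * ((c * y + a * x) + (d * y + b * x))
factor-scalar₂ = solve-∀

even-identity : ∀ k e₀ e₁ o₀ o₁ f₀ f₁ g₀ g₁ {e₂ o₂ f₂ g₂} →
  e₂ ≡ suc k * (o₁ + o₀) → o₂ ≡ suc k * (e₁ + e₀) → f₂ ≡ suc k * (g₁ + g₀) → g₂ ≡ suc k * (f₁ + f₀) →
  e₂ * f₂ + o₂ * g₂ ≡ suc k * ((e₂ * g₁ + o₂ * f₁) + suc k * ((e₁ * f₀ + o₁ * g₀) + (e₀ * f₀ + o₀ * g₀)))
even-identity k e₀ e₁ o₀ o₁ f₀ f₁ g₀ g₁ {e₂} {o₂} refl refl refl refl =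
  trans (factor-scalar₁ (suc k) e₂ o₂ g₁ g₀ f₁ f₀)
        (cong (λ z → suc k * ((e₂ * g₁ + o₂ * f₁) + z)) (factor-scalar₂ (suc k) o₁ o₀ e₁ e₀ g₀ f₀))

odd-identity : ∀ k e₁ e₂ o₁ o₂ f₀ f₁ g₀ g₁ {e₃ o₃ f₂ g₂} →
  e₃ ≡ suc (suc k) * (o₂ + o₁) → o₃ ≡ suc (suc k) * (e₂ + e₁) → f₂ ≡ suc k * (g₁ + g₀) → g₂ ≡ suc k * (f₁ + f₀) →
  e₃ * f₂ + o₃ * g₂ ≡ suc (suc k) * ((e₂ * g₂ + o₂ * f₂) + suc k * ((e₁ * f₁ + o₁ * g₁) + (e₁ * f₀ + o₁ * g₀)))
odd-identity k e₁ e₂ o₁ o₂ f₀ f₁ g₀ g₁ {f₂ = f₂} {g₂} refl refl refl refl =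
  trans (factor-scalar₂ (suc (suc k)) o₂ o₁ e₂ e₁ f₂ g₂)
        (cong (λ z → suc (suc k) * ((e₂ * g₂ + o₂ * f₂) + z)) (factor-scalar₁ (suc k) e₁ o₁ f₁ f₀ g₁ g₀))

module Convolution (e o : ℕ → ℕ)
  (e-rec : ∀ r → e (suc (suc r)) ≡ suc r * (o (suc r) + o r))
  (o-rec : ∀ r → o (suc (suc r)) ≡ suc r * (e (suc r) + e r)) where

  conv : (ℕ → ℕ) → (ℕ → ℕ) → ℕ → ℕ
  conv f g n = e ⌈ n /2⌉ * f ⌊ n /2⌋ + o ⌈ n /2⌉ * g ⌊ n /2⌋

  conv-at : ∀ f g n {a b} → ⌈ n /2⌉ ≡ a → ⌊ n /2⌋ ≡ b → conv f g n ≡ e a * f b + o a * g b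
  conv-at f g n refl refl = refl

  rhs-cong : ∀ {s s′ y y′ t t′ x x′ z z′} → s ≡ s′ → y ≡ y′ → t ≡ t′ → x ≡ x′ → z ≡ z′ →
    s * (y + t * (x + z)) ≡ s′ * (y′ + t′ * (x′ + z′))
  rhs-cong refl refl refl refl refl = refl

  module _ (f g : ℕ → ℕ)
    (f-rec : ∀ r → f (suc (suc r)) ≡ suc r * (g (suc r) + g r))
    (g-rec : ∀ r → g (suc (suc r)) ≡ suc r * (f (suc r) + f r)) where

    recurrence-even : ∀ k → RecurrenceAt (conv f g) (conv g f) (4 + double k)
    recurrence-even k = trans (conv-at f g (4 + double k) (cong (2 +_) ⌈2k/2⌉) (cong (2 +_) (⌊double/2⌋ k)))
      (trans (even-identity k (e k) (e (1 + k)) (o k) (o (1 + k)) (f k) (f (1 + k)) (g k) (g (1 + k))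
                (e-rec k) (o-rec k) (f-rec k) (g-rec k))
      (sym (rhs-cong s≡ (conv-at g f (3 + double k) (cong (2 +_) (⌊double/2⌋ k)) (cong suc ⌈2k/2⌉)) t≡
                     (conv-at f g (1 + double k) (cong suc (⌊double/2⌋ k)) ⌈2k/2⌉)
                     (conv-at f g (double k) ⌈2k/2⌉ (⌊double/2⌋ k)))))
      where
      ⌈2k/2⌉ = ⌊suc-double/2⌋ k
      s≡ : (3 + double k) / 2 ≡ suc k
      s≡ = trans (sym (⌊n/2⌋≡n/2 (3 + double k))) (cong suc ⌈2k/2⌉)
      t≡ : (2 + double k) ∸ (3 + double k) / 2 ≡ suc k
      t≡ = trans (cong ((2 + double k) ∸_) s≡) (suc-double∸ k)

    recurrence-odd : ∀ k → RecurrenceAt (conv f g) (conv g f) (5 + double k)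
    recurrence-odd k = trans (conv-at f g (5 + double k) (cong (3 +_) (⌊double/2⌋ k)) (cong (2 +_) (⌊suc-double/2⌋ k)))
      (trans (odd-identity k (e (1 + k)) (e (2 + k)) (o (1 + k)) (o (2 + k)) (f k) (f (1 + k)) (g k) (g (1 + k))
                (e-rec (1 + k)) (o-rec (1 + k)) (f-rec k) (g-rec k))
      (sym (rhs-cong s≡ (conv-at g f (4 + double k) (cong (2 +_) (⌊suc-double/2⌋ k)) (cong (2 +_) (⌊double/2⌋ k))) t≡
                     (conv-at f g (2 + double k) (cong suc (⌊suc-double/2⌋ k)) (cong suc (⌊double/2⌋ k)))
                     (conv-at f g (1 + double k) (cong suc (⌊double/2⌋ k)) (⌊suc-double/2⌋ k)))))
      where
      s≡ : (4 + double k) / 2 ≡ suc (suc k)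
      s≡ = trans (sym (⌊n/2⌋≡n/2 (4 + double k))) (cong (2 +_) (⌊double/2⌋ k))
      t≡ : (3 + double k) ∸ (4 + double k) / 2 ≡ suc k
      t≡ = trans (cong ((3 + double k) ∸_) s≡) (suc-double∸ k)

    recurrence : ∀ n → 4 ≤ n → RecurrenceAt (conv f g) (conv g f) n
    recurrence (suc (suc (suc (suc m)))) (s≤s (s≤s (s≤s (s≤s _)))) with halving m
    ... | twice k   = recurrence-even k
    ... | twice+1 k = recurrence-odd k

corollary2 : ∀ (n : ℕ) → 4 ≤ n →
    (dE n ≡ ((n ∸ 1) / 2) * (dO (n ∸ 1) + (n ∸ 2 ∸ (n ∸ 1) / 2) * (dE (n ∸ 3) + dE (n ∸ 4))))
    × (dO n ≡ ((n ∸ 1) / 2) * (dE (n ∸ 1) + (n ∸ 2 ∸ (n ∸ 1) / 2) * (dO (n ∸ 3) + dO (n ∸ 4))))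
corollary2 n 4≤n =
  RecurrenceAt-cong dE-split dO-split n (recurrence e o e-rec o-rec n 4≤n) ,
  RecurrenceAt-cong dO-split dE-split n (recurrence o e o-rec e-rec n 4≤n)
  where
  e = derangements false
  o = derangements true
  e-rec = derangements-recurrence false
  o-rec = derangements-recurrence true
  open Convolution e o e-rec o-rec
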